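{- Let $k\ge 4$, $n\ge 2k+1$, and let $\mathcal{F}\subseteq\binom{[n]}{k}$ be an intersecting family. If there are $x<y$ in $[n]$ such that $S_{xy}(\mathcal{F})$ is a family of the form $\mathcal{J}_3$, then $\mathcal{F}$ is isomorphic (up to a permutation of $[n]$) to a family of the form $\mathcal{J}_3$.
   Context: A family is intersecting if any two of its members share an element. For $x<y$ in $[n]$ and $F\in\mathcal{F}$, the shift is $S_{xy}(F)=(F\setminus\{y\})\cup\{x\}$ if $x\notin F$, $y\in F$ and $(F\setminus\{y\})\cup\{x\}\notin\mathcal{F}$, and $S_{xy}(F)=F$ otherwise; $S_{xy}(\mathcal{F})=\{S_{xy}(F):F\in\mathcal{F}\}$. For a $(k-1)$-set $E$, a point $x_0\in[n]\setminus E$ and a $3$-set $J\subseteq[n]\setminus(E\cup\{x_0\})$, a family of the form $\mathcal{J}_3$ is $\{G\in\binom{[n]}{k}:E\subseteq G,\ G\cap J\ne\emptyset\}\cup\{G\in\binom{[n]}{k}:J\cup\{x_0\}\subseteq G\}\cup\{G\in\binom{[n]}{k}:x_0\in G,\ G\cap E\ne\emptyset\}$. -}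

module Defs where

open import Data.Nat using (ℕ; _∸_)
open import Data.Bool using (Bool; true; false; if_then_else_; _∧_; not)
open import Data.Fin using (Fin)
open import Data.Fin.Subset using (Subset; _∈_; _∉_; _⊆_; _∩_; _∪_; ⁅_⁆; ∣_∣; Nonempty; Empty; inside; outside)
open import Data.Fin.Permutation using (Permutation′; _⟨$⟩ˡ_)
open import Data.Vec using (lookup; tabulate; _[_]≔_)
open import Data.Product using (Σ; _×_; ∃)
open import Data.Sum using (_⊎_)
open import Relation.Binary.PropositionalEquality using (_≡_)
open import Function.Bundles using (_⇔_)

Family : ℕ → Set
Family n = Subset n → Bool

_∈F_ : ∀ {n} → Subset n → Family n → Set
F ∈F 𝓕 = 𝓕 F ≡ true

Uniform : ∀ {n} → ℕ → Family n → Set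
Uniform k 𝓕 = ∀ F → F ∈F 𝓕 → ∣ F ∣ ≡ k

Intersecting : ∀ {n} → Family n → Set
Intersecting 𝓕 = ∀ F G → F ∈F 𝓕 → G ∈F 𝓕 → Nonempty (F ∩ G)

isIn : ∀ {n} → Fin n → Subset n → Bool
isIn i F with lookup F i
... | inside = true
... | outside = false

swapOut : ∀ {n} → Fin n → Fin n → Subset n → Subset n
swapOut x y F = (F [ y ]≔ outside) [ x ]≔ inside

shiftSet : ∀ {n} → Family n → Fin n → Fin n → Subset n → Subset n
shiftSet 𝓕 x y F =
  if not (isIn x F) ∧ isIn y F ∧ not (𝓕 (swapOut x y F))
  then swapOut x y F else F

_∈Shift[_,_,_] : ∀ {n} → Subset n → Family n → Fin n → Fin n → Set
G ∈Shift[ 𝓕 , x , y ] = Σ _ λ F → F ∈F 𝓕 × shiftSet 𝓕 x y F ≡ G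

InJ3 : ∀ {n} → ℕ → Subset n → Fin n → Subset n → Subset n → Set
InJ3 k E x₀ J G =
  ∣ G ∣ ≡ k ×
  ((E ⊆ G × Nonempty (G ∩ J)) ⊎ (J ∪ ⁅ x₀ ⁆ ⊆ G) ⊎ (x₀ ∈ G × Nonempty (G ∩ E)))

J3Params : ∀ {n} → ℕ → Subset n → Fin n → Subset n → Set
J3Params k E x₀ J = ∣ E ∣ ≡ k ∸ 1 × x₀ ∉ E × ∣ J ∣ ≡ 3 × Empty (J ∩ (E ∪ ⁅ x₀ ⁆))

IsJ3 : ∀ {n} → ℕ → (Subset n → Set) → Set
IsJ3 {n} k P = Σ (Subset n) λ E → Σ (Fin n) λ x₀ → Σ (Subset n) λ J →
  J3Params k E x₀ J × (∀ G → P G ⇔ InJ3 k E x₀ J G)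

-- image of a set under a permutation σ: σ(F) ∋ i iff σ⁻¹(i) ∈ F
permSet : ∀ {n} → Permutation′ n → Subset n → Subset n
permSet σ F = tabulate (λ i → lookup F (σ ⟨$⟩ˡ i))

_∈Perm[_,_] : ∀ {n} → Subset n → Family n → Permutation′ n → Set
G ∈Perm[ 𝓕 , σ ] = Σ _ λ F → F ∈F 𝓕 × permSet σ F ≡ G

module Submission where

-- Call H ambiguous if H ∈ 𝒥₃, x ∈ H, y ∉ H and H − x + y ∉ 𝒥₃. Since S_xy(𝓕) = 𝒥₃, every
-- k-set G other than an ambiguous set or its partner H − x + y satisfies G ∈ 𝓕 ⇔ G ∈ 𝒥₃,
-- while for ambiguous H exactly one of H and H − x + y lies in 𝓕. If ambiguous A and B
-- meet only in x, then A ∈ 𝓕 forces B ∈ 𝓕: otherwise B − x + y ∈ 𝓕 would be disjoint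
-- from A. A case analysis on the position of x and y relative to E, x₀ and J, using
-- n ≥ 2k + 1 to find such connecting sets, shows that either every ambiguous set lies
-- in 𝓕 or none does. In the first case 𝓕 = 𝒥₃; in the second, 𝓕 is the image of 𝒥₃
-- under the transposition of x and y.

open import Defs
open import Data.Nat using (ℕ; zero; suc; _+_; _*_; _∸_; _≤_; z≤n; s≤s)
import Data.Nat as Nat
open import Data.Nat.Properties
  using ( ≤-trans; ≤-reflexive; ≤-pred; n≤1+n; n<1+n; <-irrefl; m<n⇒0<n∸m; m+[n∸m]≡n; ∸-monoˡ-≤
        ; +-identityʳ; +-assoc; +-comm; +-suc; +-cancelˡ-≡; +-monoˡ-≤; +-monoʳ-≤; +-mono-≤; +-monoˡ-<
        ; m<m+n; module ≤-Reasoning )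
open import Data.Bool using (Bool; true; false)
open import Data.Bool.Properties using (¬-not; not-¬) renaming (_≟_ to _≟ᵇ_)
open import Data.Fin using (Fin; zero; suc; _<_)
open import Data.Fin.Properties using (_≟_; <⇒≢)
open import Data.Fin.Subset
open import Data.Fin.Subset.Properties
open import Data.Fin.Permutation using (Permutation′; transpose) renaming (id to idₚ)
import Data.Fin.Permutation.Components as PC
open import Data.Vec using (_∷_; []; here; there; lookup; _[_]≔_)
open import Data.Vec.Properties
  using (lookup∘update; lookup∘update′; []=⇒lookup; lookup⇒[]=; tabulate-cong; tabulate∘lookup)
open import Data.Product using (Σ; ∃; _×_; _,_; proj₁; proj₂)
open import Data.Sum using (_⊎_; inj₁; inj₂; [_,_]′)
open import Data.Empty using (⊥-elim)
open import Function.Base using (_∘_)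
open import Function.Bundles using (_⇔_; mk⇔; Equivalence)
open import Relation.Nullary using (¬_; Dec; yes; no; contradiction; ¬?)
open import Relation.Nullary.Decidable using (dec-true; dec-false; _×-dec_)
open import Relation.Binary.PropositionalEquality
  using (_≡_; _≢_; refl; sym; trans; cong; cong₂; subst; module ≡-Reasoning)

private variable
  n : ℕ
  i j : Fin n
  p q r F G H : Subset n

-- Finite subsets

Disjoint : Subset n → Subset n → Set
Disjoint p q = ∀ {i} → i ∈ p → i ∉ q

x∉p∧x∉q⇒x∉p∪q : i ∉ p → i ∉ q → i ∉ p ∪ q
x∉p∧x∉q⇒x∉p∪q {p = p} {q} i∉p i∉q i∈p∪q with x∈p∪q⁻ p q i∈p∪q
... | inj₁ i∈p = i∉p i∈p
... | inj₂ i∈q = i∉q i∈q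

x∈p─q⇒x∉q : ∀ (p q : Subset n) → i ∈ p ─ q → i ∉ q
x∈p─q⇒x∉q (inside ∷ p) (outside ∷ q) here         ()
x∈p─q⇒x∉q (_      ∷ p) (_       ∷ q) (there i∈p─q) (there i∈q) = x∈p─q⇒x∉q p q i∈p─q i∈q

x∈p-y⇒x≢y : i ∈ p - j → i ≢ j
x∈p-y⇒x≢y {p = p} {j} i∈p-j refl = x∈p─q⇒x∉q p ⁅ j ⁆ i∈p-j (x∈⁅x⁆ j)

x∉p-x : ∀ (p : Subset n) (i : Fin n) → i ∉ p - i
x∉p-x p i i∈p-i = x∈p-y⇒x≢y i∈p-i refl

x∉p⇒x∉p-y : i ∉ p → i ∉ p - j
x∉p⇒x∉p-y {p = p} {j} i∉p i∈p-j = i∉p (p─q⊆p p ⁅ j ⁆ i∈p-j)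

x∈⁅x⁆∪⁅y⁆ : ∀ (i j : Fin n) → i ∈ ⁅ i ⁆ ∪ ⁅ j ⁆
x∈⁅x⁆∪⁅y⁆ i j = p⊆p∪q ⁅ j ⁆ (x∈⁅x⁆ i)

y∈⁅x⁆∪⁅y⁆ : ∀ (i j : Fin n) → j ∈ ⁅ i ⁆ ∪ ⁅ j ⁆
y∈⁅x⁆∪⁅y⁆ i j = q⊆p∪q ⁅ i ⁆ ⁅ j ⁆ (x∈⁅x⁆ j)

x∉⁅y⁆∪⁅z⁆ : ∀ {l} → i ≢ j → i ≢ l → i ∉ ⁅ j ⁆ ∪ ⁅ l ⁆
x∉⁅y⁆∪⁅z⁆ i≢j i≢l = x∉p∧x∉q⇒x∉p∪q (x≢y⇒x∉⁅y⁆ i≢j) (x≢y⇒x∉⁅y⁆ i≢l)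

p⊆r∧q⊆r⇒p∪q⊆r : p ⊆ r → q ⊆ r → p ∪ q ⊆ r
p⊆r∧q⊆r⇒p∪q⊆r {p = p} {q = q} p⊆r q⊆r i∈p∪q with x∈p∪q⁻ p q i∈p∪q
... | inj₁ i∈p = p⊆r i∈p
... | inj₂ i∈q = q⊆r i∈q

p⊈q⇒∃x∈p∖q : ∀ (p q : Subset n) → ¬ p ⊆ q → ∃ λ i → i ∈ p × i ∉ q
p⊈q⇒∃x∈p∖q p q p⊈q with nonempty? (p ─ q)
... | yes (i , i∈p─q) = i , p─q⊆p p q i∈p─q , x∈p─q⇒x∉q p q i∈p─q
... | no  p─q-empty   = ⊥-elim (p⊈q p⊆q)
  where
  p⊆q : p ⊆ q
  p⊆q {i} i∈p with i ∈? q
  ... | yes i∈q = i∈q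
  ... | no  i∉q = contradiction (i , x∈p∧x∉q⇒x∈p─q i∈p i∉q) p─q-empty

Disjoint-⁅x⁆ : i ∉ p → Disjoint ⁅ i ⁆ p
Disjoint-⁅x⁆ {i = i} i∉p j∈⁅i⁆ rewrite x∈⁅y⁆⇒x≡y i j∈⁅i⁆ = i∉p

Disjoint-sym : Disjoint p q → Disjoint q p
Disjoint-sym p#q i∈q i∈p = p#q i∈p i∈q

Disjoint-tail : ∀ {s t} → Disjoint (s ∷ p) (t ∷ q) → Disjoint p q
Disjoint-tail p#q i∈p i∈q = p#q (there i∈p) (there i∈q)

Disjoint-∪⁺ : Disjoint p r → Disjoint q r → Disjoint (p ∪ q) r
Disjoint-∪⁺ {p = p} {q = q} p#r q#r i∈p∪q with x∈p∪q⁻ p q i∈p∪q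
... | inj₁ i∈p = p#r i∈p
... | inj₂ i∈q = q#r i∈q

Disjoint-⁅x⁆∪⁅y⁆ : i ∉ p → j ∉ p → Disjoint (⁅ i ⁆ ∪ ⁅ j ⁆) p
Disjoint-⁅x⁆∪⁅y⁆ i∉p j∉p = Disjoint-∪⁺ (Disjoint-⁅x⁆ i∉p) (Disjoint-⁅x⁆ j∉p)

Disjoint-∪ˡ : Disjoint r (p ∪ q) → Disjoint r p
Disjoint-∪ˡ {q = q} r#p∪q i∈r i∈p = r#p∪q i∈r (p⊆p∪q q i∈p)

Disjoint-∪ʳ : Disjoint r (p ∪ q) → Disjoint r q
Disjoint-∪ʳ {p = p} {q} r#p∪q i∈r i∈q = r#p∪q i∈r (q⊆p∪q p q i∈q)

Disjoint-p-x⇒∩⊆⁅x⁆ : Disjoint r (p - i) → r ∩ p ⊆ ⁅ i ⁆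
Disjoint-p-x⇒∩⊆⁅x⁆ {r = r} {p = p} {i} r#p-i {j} j∈r∩p with x∈p∩q⁻ r p j∈r∩p | j ≟ i
... | _         , _   | yes refl = x∈⁅x⁆ j
... | j∈r , j∈p | no  j≢i  = contradiction (x∈p∧x≢y⇒x∈p-y j∈p j≢i) (r#p-i j∈r)

Disjoint-[p-x]∪q⇒∩⊆⁅x⁆ : Disjoint r ((p - i) ∪ q) → r ∩ p ⊆ ⁅ i ⁆
Disjoint-[p-x]∪q⇒∩⊆⁅x⁆ r# = Disjoint-p-x⇒∩⊆⁅x⁆ (Disjoint-∪ˡ r#)

∣p∪q∣≤∣p∣+∣q∣ : ∀ (p q : Subset n) → ∣ p ∪ q ∣ ≤ ∣ p ∣ + ∣ q ∣
∣p∪q∣≤∣p∣+∣q∣ []            []            = z≤n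
∣p∪q∣≤∣p∣+∣q∣ (inside  ∷ p) (inside  ∷ q) =
  s≤s (≤-trans (∣p∪q∣≤∣p∣+∣q∣ p q) (≤-trans (n≤1+n _) (≤-reflexive (sym (+-suc _ _)))))
∣p∪q∣≤∣p∣+∣q∣ (inside  ∷ p) (outside ∷ q) = s≤s (∣p∪q∣≤∣p∣+∣q∣ p q)
∣p∪q∣≤∣p∣+∣q∣ (outside ∷ p) (inside  ∷ q) = ≤-trans (s≤s (∣p∪q∣≤∣p∣+∣q∣ p q)) (≤-reflexive (sym (+-suc _ _)))
∣p∪q∣≤∣p∣+∣q∣ (outside ∷ p) (outside ∷ q) = ∣p∪q∣≤∣p∣+∣q∣ p q

∣p∪q∣≡∣p∣+∣q∣ : ∀ (p q : Subset n) → Disjoint p q → ∣ p ∪ q ∣ ≡ ∣ p ∣ + ∣ q ∣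
∣p∪q∣≡∣p∣+∣q∣ []            []            _   = refl
∣p∪q∣≡∣p∣+∣q∣ (inside  ∷ p) (inside  ∷ q) p#q = contradiction here (p#q here)
∣p∪q∣≡∣p∣+∣q∣ (inside  ∷ p) (outside ∷ q) p#q = cong suc (∣p∪q∣≡∣p∣+∣q∣ p q (Disjoint-tail p#q))
∣p∪q∣≡∣p∣+∣q∣ (outside ∷ p) (inside  ∷ q) p#q =
  trans (cong suc (∣p∪q∣≡∣p∣+∣q∣ p q (Disjoint-tail p#q))) (sym (+-suc _ _))
∣p∪q∣≡∣p∣+∣q∣ (outside ∷ p) (outside ∷ q) p#q = ∣p∪q∣≡∣p∣+∣q∣ p q (Disjoint-tail p#q)

∣p∣≡∣p∩q∣+∣p─q∣ : ∀ (p q : Subset n) → ∣ p ∣ ≡ ∣ p ∩ q ∣ + ∣ p ─ q ∣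
∣p∣≡∣p∩q∣+∣p─q∣ []            []            = refl
∣p∣≡∣p∩q∣+∣p─q∣ (inside  ∷ p) (inside  ∷ q) = cong suc (∣p∣≡∣p∩q∣+∣p─q∣ p q)
∣p∣≡∣p∩q∣+∣p─q∣ (inside  ∷ p) (outside ∷ q) = trans (cong suc (∣p∣≡∣p∩q∣+∣p─q∣ p q)) (sym (+-suc _ _))
∣p∣≡∣p∩q∣+∣p─q∣ (outside ∷ p) (inside  ∷ q) = ∣p∣≡∣p∩q∣+∣p─q∣ p q
∣p∣≡∣p∩q∣+∣p─q∣ (outside ∷ p) (outside ∷ q) = ∣p∣≡∣p∩q∣+∣p─q∣ p q

∣p∣≡∣q∣⇒∣p─q∣≡∣q─p∣ : ∀ (p q : Subset n) → ∣ p ∣ ≡ ∣ q ∣ → ∣ p ─ q ∣ ≡ ∣ q ─ p ∣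
∣p∣≡∣q∣⇒∣p─q∣≡∣q─p∣ p q ∣p∣≡∣q∣ = +-cancelˡ-≡ ∣ p ∩ q ∣ _ _ (begin
  ∣ p ∩ q ∣ + ∣ p ─ q ∣  ≡⟨ ∣p∣≡∣p∩q∣+∣p─q∣ p q ⟨
  ∣ p ∣                  ≡⟨ ∣p∣≡∣q∣ ⟩
  ∣ q ∣                  ≡⟨ ∣p∣≡∣p∩q∣+∣p─q∣ q p ⟩
  ∣ q ∩ p ∣ + ∣ q ─ p ∣  ≡⟨ cong (λ r → ∣ r ∣ + ∣ q ─ p ∣) (∩-comm q p) ⟩
  ∣ p ∩ q ∣ + ∣ q ─ p ∣  ∎)
  where open ≡-Reasoning

∣p∣≤1+∣p-x∣ : ∀ (p : Subset n) (j : Fin n) → ∣ p ∣ ≤ suc ∣ p - j ∣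
∣p∣≤1+∣p-x∣ p j = begin
  ∣ p ∣                       ≡⟨ ∣p∣≡∣p∩q∣+∣p─q∣ p ⁅ j ⁆ ⟩
  ∣ p ∩ ⁅ j ⁆ ∣ + ∣ p - j ∣   ≤⟨ +-monoˡ-≤ _ (∣p∩q∣≤∣q∣ p ⁅ j ⁆) ⟩
  ∣ ⁅ j ⁆ ∣ + ∣ p - j ∣       ≡⟨ cong (_+ ∣ p - j ∣) (∣⁅x⁆∣≡1 j) ⟩
  suc ∣ p - j ∣               ∎
  where open ≤-Reasoning

∣⁅x⁆∪⁅y⁆∣≤2 : ∀ (i j : Fin n) → ∣ ⁅ i ⁆ ∪ ⁅ j ⁆ ∣ ≤ 2
∣⁅x⁆∪⁅y⁆∣≤2 i j = ≤-trans (∣p∪q∣≤∣p∣+∣q∣ ⁅ i ⁆ ⁅ j ⁆) (≤-reflexive (cong₂ _+_ (∣⁅x⁆∣≡1 i) (∣⁅x⁆∣≡1 j)))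

x∈p⇒0<∣p∣ : i ∈ p → 0 Nat.< ∣ p ∣
x∈p⇒0<∣p∣ {i = i} {p} i∈p = ≤-trans (≤-reflexive (sym (∣⁅x⁆∣≡1 i))) (p⊆q⇒∣p∣≤∣q∣ ⁅i⁆⊆p)
  where
  ⁅i⁆⊆p : ⁅ i ⁆ ⊆ p
  ⁅i⁆⊆p j∈⁅i⁆ rewrite x∈⁅y⁆⇒x≡y i j∈⁅i⁆ = i∈p

0<∣p∣⇒Nonempty : ∀ (p : Subset n) → 0 Nat.< ∣ p ∣ → Nonempty p
0<∣p∣⇒Nonempty {n} p 0<∣p∣ with nonempty? p
... | yes p-nonempty = p-nonempty
... | no  p-empty    with () ← ≤-trans 0<∣p∣ (≤-reflexive (trans (cong ∣_∣ (Empty-unique p-empty)) (∣⊥∣≡0 n)))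

p⊆q∧∣p∣≡∣q∣⇒p≡q : p ⊆ q → ∣ p ∣ ≡ ∣ q ∣ → p ≡ q
p⊆q∧∣p∣≡∣q∣⇒p≡q {p = p} {q} p⊆q ∣p∣≡∣q∣ with q ⊆? p
... | yes q⊆p = ⊆-antisym p⊆q q⊆p
... | no  q⊈p with p⊈q⇒∃x∈p∖q q p q⊈p
...   | i , i∈q , i∉p = contradiction (p⊂q⇒∣p∣<∣q∣ (p⊆q , i , i∈q , i∉p)) (<-irrefl ∣p∣≡∣q∣)

2≤∣p∣⇒∃x∈p∧x≢y : ∀ (p : Subset n) (j : Fin n) → 2 ≤ ∣ p ∣ → ∃ λ i → i ∈ p × i ≢ j
2≤∣p∣⇒∃x∈p∧x≢y p j 2≤∣p∣ with 0<∣p∣⇒Nonempty (p - j) (≤-pred (≤-trans 2≤∣p∣ (∣p∣≤1+∣p-x∣ p j)))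
... | i , i∈p-j = i , p─q⊆p p ⁅ j ⁆ i∈p-j , x∈p-y⇒x≢y i∈p-j

∣p∣≡∣q∣∧x∈p∖q⇒∃y∈q∖p : ∀ (p q : Subset n) → ∣ p ∣ ≡ ∣ q ∣ → i ∈ p → i ∉ q → ∃ λ j → j ∈ q × j ∉ p
∣p∣≡∣q∣∧x∈p∖q⇒∃y∈q∖p p q ∣p∣≡∣q∣ i∈p i∉q
  with 0<∣p∣⇒Nonempty (q ─ p) (subst (0 Nat.<_) (∣p∣≡∣q∣⇒∣p─q∣≡∣q─p∣ p q ∣p∣≡∣q∣)
                                                  (x∈p⇒0<∣p∣ (x∈p∧x∉q⇒x∈p─q i∈p i∉q)))
... | j , j∈q─p = j , p─q⊆p q p j∈q─p , x∈p─q⇒x∉q q p j∈q─p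

∣p∣<n⇒∃x∉p : ∀ (p : Subset n) → ∣ p ∣ Nat.< n → ∃ λ i → i ∉ p
∣p∣<n⇒∃x∉p {n} p ∣p∣<n
  with 0<∣p∣⇒Nonempty (∁ p) (subst (0 Nat.<_) (sym (∣∁p∣≡n∸∣p∣ p)) (m<n⇒0<n∸m ∣p∣<n))
... | i , i∈∁p = i , x∈∁p⇒x∉p i∈∁p

record Extension (k : ℕ) (A B : Subset n) : Set where
  constructor extension
  field
    set    : Subset n
    size   : ∣ set ∣ ≡ k
    ⊇A     : A ⊆ set
    avoids : Disjoint set B

-- Opaque: no argument depends on which extension is chosen, and unfolding it makes type
-- checking of its uses blow up.
opaque
  extend : ∀ k (A B : Subset n) → Disjoint A B → ∣ A ∣ ≤ k → k + ∣ B ∣ ≤ n → Extension k A B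
  extend {n} k A B A#B ∣A∣≤k k+∣B∣≤n = grow (k ∸ ∣ A ∣) A A#B (m+[n∸m]≡n ∣A∣≤k) ⊆-refl
    where
    grow : ∀ d A′ → Disjoint A′ B → ∣ A′ ∣ + d ≡ k → A ⊆ A′ → Extension k A B
    grow zero    A′ A′#B ∣A′∣+0≡k A⊆A′ = extension A′ (trans (sym (+-identityʳ _)) ∣A′∣+0≡k) A⊆A′ A′#B
    grow (suc d) A′ A′#B ∣A′∣+1+d≡k A⊆A′ with ∣p∣<n⇒∃x∉p (A′ ∪ B) ∣A′∪B∣<n
      where
      ∣A′∪B∣<n : ∣ A′ ∪ B ∣ Nat.< n
      ∣A′∪B∣<n = begin-strict
        ∣ A′ ∪ B ∣             ≤⟨ ∣p∪q∣≤∣p∣+∣q∣ A′ B ⟩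
        ∣ A′ ∣ + ∣ B ∣         <⟨ +-monoˡ-< ∣ B ∣ (m<m+n ∣ A′ ∣ (s≤s z≤n)) ⟩
        ∣ A′ ∣ + suc d + ∣ B ∣ ≡⟨ cong (_+ ∣ B ∣) ∣A′∣+1+d≡k ⟩
        k + ∣ B ∣              ≤⟨ k+∣B∣≤n ⟩
        n                      ∎
        where open ≤-Reasoning
    ... | i , i∉A′∪B = grow d (A′ ∪ ⁅ i ⁆) A′∪⁅i⁆#B ∣A′∪⁅i⁆∣+d≡k (p⊆p∪q ⁅ i ⁆ ∘ A⊆A′)
      where
      A′#⁅i⁆ : Disjoint A′ ⁅ i ⁆
      A′#⁅i⁆ = Disjoint-sym (Disjoint-⁅x⁆ (i∉A′∪B ∘ p⊆p∪q B))
      A′∪⁅i⁆#B : Disjoint (A′ ∪ ⁅ i ⁆) B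
      A′∪⁅i⁆#B = Disjoint-∪⁺ A′#B (Disjoint-⁅x⁆ (i∉A′∪B ∘ q⊆p∪q A′ B))
      ∣A′∪⁅i⁆∣+d≡k : ∣ A′ ∪ ⁅ i ⁆ ∣ + d ≡ k
      ∣A′∪⁅i⁆∣+d≡k = begin
        ∣ A′ ∪ ⁅ i ⁆ ∣ + d       ≡⟨ cong (_+ d) (∣p∪q∣≡∣p∣+∣q∣ A′ ⁅ i ⁆ A′#⁅i⁆) ⟩
        ∣ A′ ∣ + ∣ ⁅ i ⁆ ∣ + d   ≡⟨ cong (λ m → ∣ A′ ∣ + m + d) (∣⁅x⁆∣≡1 i) ⟩
        ∣ A′ ∣ + 1 + d           ≡⟨ +-assoc ∣ A′ ∣ 1 d ⟩
        ∣ A′ ∣ + suc d           ≡⟨ ∣A′∣+1+d≡k ⟩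
        k                        ∎
        where open ≡-Reasoning

-- Swaps and transpositions

∉⇒lookup≡outside : i ∉ p → lookup p i ≡ outside
∉⇒lookup≡outside {i = i} {p} i∉p with lookup p i in eq
... | true  = contradiction (lookup⇒[]= i p eq) i∉p
... | false = refl

lookup-ext : ∀ (p q : Subset n) → (∀ i → lookup p i ≡ lookup q i) → p ≡ q
lookup-ext p q eq = trans (sym (tabulate∘lookup p)) (trans (tabulate-cong eq) (tabulate∘lookup q))

isIn-∈ : i ∈ p → isIn i p ≡ true
isIn-∈ {i = i} {p} i∈p with lookup p i | []=⇒lookup i∈p
... | .inside | refl = refl

isIn-∉ : i ∉ p → isIn i p ≡ false
isIn-∉ {i = i} {p} i∉p with lookup p i | ∉⇒lookup≡outside i∉p
... | .outside | refl = refl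

∣p[i]≔inside∣ : ∀ (p : Subset n) → i ∉ p → ∣ p [ i ]≔ inside ∣ ≡ suc ∣ p ∣
∣p[i]≔inside∣ {i = zero}  (inside  ∷ p) i∉p = contradiction here i∉p
∣p[i]≔inside∣ {i = zero}  (outside ∷ p) _   = refl
∣p[i]≔inside∣ {i = suc i} (inside  ∷ p) i∉p = cong suc (∣p[i]≔inside∣ p (i∉p ∘ there))
∣p[i]≔inside∣ {i = suc i} (outside ∷ p) i∉p = ∣p[i]≔inside∣ p (i∉p ∘ there)

∣p[i]≔outside∣ : ∀ (p : Subset n) → i ∈ p → suc ∣ p [ i ]≔ outside ∣ ≡ ∣ p ∣
∣p[i]≔outside∣ (inside  ∷ p) here        = refl
∣p[i]≔outside∣ (inside  ∷ p) (there i∈p) = cong suc (∣p[i]≔outside∣ p i∈p)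
∣p[i]≔outside∣ (outside ∷ p) (there i∈p) = ∣p[i]≔outside∣ p i∈p

module _ (a b : Fin n) (F : Subset n) where

  lookup-swapOut-new : lookup (swapOut a b F) a ≡ inside
  lookup-swapOut-new = lookup∘update a (F [ b ]≔ outside) inside

  lookup-swapOut-old : a ≢ b → lookup (swapOut a b F) b ≡ outside
  lookup-swapOut-old a≢b =
    trans (lookup∘update′ (a≢b ∘ sym) (F [ b ]≔ outside) inside) (lookup∘update b F outside)

  lookup-swapOut-other : i ≢ a → i ≢ b → lookup (swapOut a b F) i ≡ lookup F i
  lookup-swapOut-other i≢a i≢b =
    trans (lookup∘update′ i≢a (F [ b ]≔ outside) inside) (lookup∘update′ i≢b F outside)

  swapOut-∋new : a ∈ swapOut a b F
  swapOut-∋new = lookup⇒[]= a _ lookup-swapOut-new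

  swapOut-∌old : a ≢ b → b ∉ swapOut a b F
  swapOut-∌old a≢b b∈ with () ← trans (sym ([]=⇒lookup b∈)) (lookup-swapOut-old a≢b)

  swapOut-keeps : i ≢ b → i ∈ F → i ∈ swapOut a b F
  swapOut-keeps {i} i≢b i∈F with i ≟ a
  ... | yes refl = swapOut-∋new
  ... | no  i≢a  = lookup⇒[]= i _ (trans (lookup-swapOut-other i≢a i≢b) ([]=⇒lookup i∈F))

  ∈-swapOut⁻ : a ≢ b → i ∈ swapOut a b F → i ≡ a ⊎ (i ≢ b × i ∈ F)
  ∈-swapOut⁻ {i} a≢b i∈ with i ≟ a | i ≟ b
  ... | yes i≡a | _        = inj₁ i≡a
  ... | no  _   | yes refl = contradiction i∈ (swapOut-∌old a≢b)
  ... | no  i≢a | no  i≢b  =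
    inj₂ (i≢b , lookup⇒[]= i F (trans (sym (lookup-swapOut-other i≢a i≢b)) ([]=⇒lookup i∈)))

  ∣swapOut∣ : a ∉ F → b ∈ F → ∣ swapOut a b F ∣ ≡ ∣ F ∣
  ∣swapOut∣ a∉F b∈F = trans (∣p[i]≔inside∣ (F [ b ]≔ outside) a∉F[b]≔outside) (∣p[i]≔outside∣ F b∈F)
    where
    a∉F[b]≔outside : a ∉ F [ b ]≔ outside
    a∉F[b]≔outside a∈ with a ≟ b
    ... | yes refl = contradiction b∈F a∉F
    ... | no  a≢b  = a∉F (lookup⇒[]= a F (trans (sym (lookup∘update′ a≢b F outside)) ([]=⇒lookup a∈)))

swapOut-inverse : ∀ {a b : Fin n} → a ∉ F → b ∈ F → swapOut b a (swapOut a b F) ≡ F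
swapOut-inverse {F = F} {a} {b} a∉F b∈F = lookup-ext _ F pointwise
  where
  F′ : Subset _
  F′ = swapOut a b F
  pointwise : ∀ i → lookup (swapOut b a F′) i ≡ lookup F i
  pointwise i with i ≟ b | i ≟ a
  ... | yes refl | _        = trans (lookup-swapOut-new b a F′) (sym ([]=⇒lookup b∈F))
  ... | no  _    | yes refl =
    trans (lookup-swapOut-old b a F′ λ { refl → a∉F b∈F }) (sym (∉⇒lookup≡outside a∉F))
  ... | no  i≢b  | no  i≢a  = trans (lookup-swapOut-other b a F′ i≢b i≢a) (lookup-swapOut-other a b F i≢a i≢b)

∣swapOut─∣<∣─∣ : ∀ {a b} (S R : Subset n) → a ∈ S ─ R → b ∈ R → ∣ swapOut b a S ─ R ∣ Nat.< ∣ S ─ R ∣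
∣swapOut─∣<∣─∣ {a = a} {b} S R a∈S─R b∈R = p⊂q⇒∣p∣<∣q∣ (S′─R⊆S─R , a , a∈S─R , a∉S′─R)
  where
  b≢a : b ≢ a
  b≢a refl = x∈p─q⇒x∉q S R a∈S─R b∈R
  S′─R⊆S─R : swapOut b a S ─ R ⊆ S ─ R
  S′─R⊆S─R z∈ with ∈-swapOut⁻ b a S b≢a (p─q⊆p _ R z∈)
  ... | inj₁ refl      = contradiction b∈R (x∈p─q⇒x∉q _ R z∈)
  ... | inj₂ (_ , z∈S) = x∈p∧x∉q⇒x∈p─q z∈S (x∈p─q⇒x∉q _ R z∈)
  a∉S′─R : a ∉ swapOut b a S ─ R
  a∉S′─R a∈ with ∈-swapOut⁻ b a S b≢a (p─q⊆p _ R a∈)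
  ... | inj₁ a≡b       = b≢a (sym a≡b)
  ... | inj₂ (a≢a , _) = a≢a refl

module _ {x y : Fin n} (x≢y : x ≢ y) where

  private
    τ : Permutation′ n
    τ = transpose x y

  permSet-transpose : ∀ (G H : Subset n) → lookup G y ≡ lookup H x → lookup G x ≡ lookup H y →
                      (∀ i → i ≢ x → i ≢ y → lookup G i ≡ lookup H i) → permSet τ G ≡ H
  permSet-transpose G H Gy≡Hx Gx≡Hy rest =
    trans (tabulate-cong λ i → pointwise i (i ≟ y) (i ≟ x)) (tabulate∘lookup H)
    where
    transpose-y : PC.transpose y x y ≡ x
    transpose-y rewrite dec-true (y ≟ y) refl = refl

    transpose-x : PC.transpose y x x ≡ y
    transpose-x rewrite dec-false (x ≟ y) x≢y | dec-true (x ≟ x) refl = refl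

    transpose-other : i ≢ y → i ≢ x → PC.transpose y x i ≡ i
    transpose-other {i} i≢y i≢x rewrite dec-false (i ≟ y) i≢y | dec-false (i ≟ x) i≢x = refl

    pointwise : ∀ i → Dec (i ≡ y) → Dec (i ≡ x) → lookup G (PC.transpose y x i) ≡ lookup H i
    pointwise i (yes refl) _          = trans (cong (lookup G) transpose-y) Gx≡Hy
    pointwise i (no  i≢y)  (yes refl) = trans (cong (lookup G) transpose-x) Gy≡Hx
    pointwise i (no  i≢y)  (no  i≢x)  = trans (cong (lookup G) (transpose-other i≢y i≢x)) (rest i i≢x i≢y)

  permSet-transpose-fixes : ∀ G → (x ∈ G → y ∈ G) → (y ∈ G → x ∈ G) → permSet τ G ≡ G
  permSet-transpose-fixes G x⇒y y⇒x = permSet-transpose G G Gy≡Gx (sym Gy≡Gx) (λ _ _ _ → refl)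
    where
    Gy≡Gx : lookup G y ≡ lookup G x
    Gy≡Gx with lookup G x in Gx | lookup G y in Gy
    ... | true  | true  = refl
    ... | false | false = refl
    ... | true  | false = trans (sym Gy) ([]=⇒lookup (x⇒y (lookup⇒[]= x G Gx)))
    ... | false | true  = trans (sym ([]=⇒lookup (y⇒x (lookup⇒[]= y G Gy)))) Gx

  permSet-transpose-down : ∀ G → x ∉ G → y ∈ G → permSet τ G ≡ swapOut x y G
  permSet-transpose-down G x∉G y∈G = permSet-transpose G _
    (trans ([]=⇒lookup y∈G) (sym (lookup-swapOut-new x y G)))
    (trans (∉⇒lookup≡outside x∉G) (sym (lookup-swapOut-old x y G x≢y)))
    (λ i i≢x i≢y → sym (lookup-swapOut-other x y G i≢x i≢y))

  permSet-transpose-up : ∀ G → x ∈ G → y ∉ G → permSet τ G ≡ swapOut y x G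
  permSet-transpose-up G x∈G y∉G = permSet-transpose G _
    (trans (∉⇒lookup≡outside y∉G) (sym (lookup-swapOut-old y x G (x≢y ∘ sym))))
    (trans ([]=⇒lookup x∈G) (sym (lookup-swapOut-new y x G)))
    (λ i i≢x i≢y → sym (lookup-swapOut-other y x G i≢y i≢x))

  private
    twice : permSet τ G ≡ G → permSet τ (permSet τ G) ≡ G
    twice τG≡G = trans (cong (permSet τ) τG≡G) τG≡G

  permSet-transpose-involutive : ∀ G → permSet τ (permSet τ G) ≡ G
  permSet-transpose-involutive G with x ∈? G | y ∈? G
  ... | yes x∈G | yes y∈G = twice (permSet-transpose-fixes G (λ _ → y∈G) (λ _ → x∈G))
  ... | no  x∉G | no  y∉G =
    twice (permSet-transpose-fixes G (λ x∈G → contradiction x∈G x∉G) (λ y∈G → contradiction y∈G y∉G))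
  ... | no  x∉G | yes y∈G = begin
    permSet τ (permSet τ G)    ≡⟨ cong (permSet τ) (permSet-transpose-down G x∉G y∈G) ⟩
    permSet τ (swapOut x y G)  ≡⟨ permSet-transpose-up _ (swapOut-∋new x y G) (swapOut-∌old x y G x≢y) ⟩
    swapOut y x (swapOut x y G) ≡⟨ swapOut-inverse x∉G y∈G ⟩
    G                           ∎
    where open ≡-Reasoning
  ... | yes x∈G | no  y∉G = begin
    permSet τ (permSet τ G)    ≡⟨ cong (permSet τ) (permSet-transpose-up G x∈G y∉G) ⟩
    permSet τ (swapOut y x G)  ≡⟨ permSet-transpose-down _ (swapOut-∌old y x G (x≢y ∘ sym))
                                                         (swapOut-∋new y x G) ⟩
    swapOut x y (swapOut y x G) ≡⟨ swapOut-inverse y∉G x∈G ⟩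
    G                           ∎
    where open ≡-Reasoning

involutive⇒∈Perm⇔ : ∀ {P : Subset n → Set} (𝓕 : Family n) (σ : Permutation′ n) →
                    (∀ G → permSet σ (permSet σ G) ≡ G) → (∀ G → permSet σ G ∈F 𝓕 ⇔ P G) →
                    ∀ G → G ∈Perm[ 𝓕 , σ ] ⇔ P G
involutive⇒∈Perm⇔ 𝓕 σ involutive σG∈𝓕⇔P G = mk⇔
  (λ { (F , F∈𝓕 , σF≡G) → Equivalence.to (σG∈𝓕⇔P G)
         (subst (_∈F 𝓕) (sym (trans (cong (permSet σ) (sym σF≡G)) (involutive F))) F∈𝓕) })
  (λ PG → permSet σ G , Equivalence.from (σG∈𝓕⇔P G) PG , involutive G)

-- Families whose shift is a given family

module ShiftedOnto {n : ℕ} (𝓕 : Family n) {x y : Fin n} (x≢y : x ≢ y) (Q : Subset n → Set)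
                   (shift≈Q : ∀ G → G ∈Shift[ 𝓕 , x , y ] ⇔ Q G) where

  down up : Subset n → Subset n
  down F = swapOut x y F
  up G = swapOut y x G

  x∈down : x ∈ down F
  x∈down = swapOut-∋new x y _

  y∉down : y ∉ down F
  y∉down = swapOut-∌old x y _ x≢y

  y∈up : y ∈ up G
  y∈up = swapOut-∋new y x _

  x∉up : x ∉ up G
  x∉up = swapOut-∌old y x _ (x≢y ∘ sym)

  up-keeps : i ≢ x → i ∈ G → i ∈ up G
  up-keeps = swapOut-keeps y x _

  ∈up⁻ : i ∈ up G → i ≡ y ⊎ (i ≢ x × i ∈ G)
  ∈up⁻ = ∈-swapOut⁻ y x _ (x≢y ∘ sym)

  ∉up : i ≢ y → i ∉ G → i ∉ up G
  ∉up i≢y i∉G i∈up with ∈up⁻ i∈up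
  ... | inj₁ i≡y       = i≢y i≡y
  ... | inj₂ (_ , i∈G) = i∉G i∈G

  ∣up∣ : x ∈ G → y ∉ G → ∣ up G ∣ ≡ ∣ G ∣
  ∣up∣ x∈G y∉G = ∣swapOut∣ y x _ y∉G x∈G

  Moving : Subset n → Set
  Moving F = x ∉ F × y ∈ F × 𝓕 (down F) ≡ false

  moving? : ∀ F → Dec (Moving F)
  moving? F = ¬? (x ∈? F) ×-dec y ∈? F ×-dec 𝓕 (down F) ≟ᵇ false

  shiftSet-moving : Moving F → shiftSet 𝓕 x y F ≡ down F
  shiftSet-moving (x∉F , y∈F , down∉𝓕) rewrite isIn-∉ x∉F | isIn-∈ y∈F | down∉𝓕 = refl

  shiftSet-fixed : ¬ Moving F → shiftSet 𝓕 x y F ≡ F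
  shiftSet-fixed {F = F} ¬moving with x ∈? F | y ∈? F
  ... | yes x∈F | _       rewrite isIn-∈ x∈F = refl
  ... | no  x∉F | no  y∉F rewrite isIn-∉ x∉F | isIn-∉ y∉F = refl
  ... | no  x∉F | yes y∈F
    rewrite isIn-∉ x∉F | isIn-∈ y∈F | ¬-not {𝓕 (down F)} (λ down∉𝓕 → ¬moving (x∉F , y∈F , down∉𝓕)) = refl

  ∈𝓕⇒Q-shiftSet : F ∈F 𝓕 → Q (shiftSet 𝓕 x y F)
  ∈𝓕⇒Q-shiftSet {F = F} F∈𝓕 = Equivalence.to (shift≈Q _) (F , F∈𝓕 , refl)

  Q⇒preimage : Q G → (G ∈F 𝓕 × ¬ Moving G) ⊎ (∃ λ F → F ∈F 𝓕 × Moving F × down F ≡ G)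
  Q⇒preimage {G = G} QG with Equivalence.from (shift≈Q G) QG
  ... | F , F∈𝓕 , SF≡G with moving? F
  ...   | yes moving = inj₂ (F , F∈𝓕 , moving , trans (sym (shiftSet-moving moving)) SF≡G)
  ...   | no ¬moving = inj₁ (subst (_∈F 𝓕) F≡G F∈𝓕 , subst (¬_ ∘ Moving) F≡G ¬moving)
    where
    F≡G : F ≡ G
    F≡G = trans (sym (shiftSet-fixed ¬moving)) SF≡G

  fixed⇒Q : F ∈F 𝓕 → ¬ Moving F → Q F
  fixed⇒Q F∈𝓕 ¬moving = subst Q (shiftSet-fixed ¬moving) (∈𝓕⇒Q-shiftSet F∈𝓕)

  ∈𝓕⇒Q-down : F ∈F 𝓕 → x ∉ F → y ∈ F → Q (down F)
  ∈𝓕⇒Q-down {F = F} F∈𝓕 x∉F y∈F with 𝓕 (down F) in down∈?𝓕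
  ... | true  = fixed⇒Q down∈?𝓕 λ (x∉down , _) → x∉down x∈down
  ... | false = subst Q (shiftSet-moving (x∉F , y∈F , down∈?𝓕)) (∈𝓕⇒Q-shiftSet F∈𝓕)

  moving⇒¬Q : Moving F → ¬ Q F
  moving⇒¬Q moving QF with Q⇒preimage QF
  ... | inj₁ (_ , ¬moving)      = ¬moving moving
  ... | inj₂ (_ , _ , _ , refl) = proj₁ moving x∈down

  Q⇒∈𝓕 : Q G → x ∉ G ⊎ y ∈ G → G ∈F 𝓕
  Q⇒∈𝓕 QG x∉G⊎y∈G with Q⇒preimage QG | x∉G⊎y∈G
  ... | inj₁ (G∈𝓕 , _)         | _        = G∈𝓕
  ... | inj₂ (_ , _ , _ , refl) | inj₁ x∉G = contradiction x∈down x∉G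
  ... | inj₂ (_ , _ , _ , refl) | inj₂ y∈G = contradiction y∈G y∉down

  Q⇒∈𝓕⊎up∈𝓕 : Q G → G ∈F 𝓕 ⊎ up G ∈F 𝓕
  Q⇒∈𝓕⊎up∈𝓕 QG with Q⇒preimage QG
  ... | inj₁ (G∈𝓕 , _)                          = inj₁ G∈𝓕
  ... | inj₂ (F , F∈𝓕 , (x∉F , y∈F , _) , refl) = inj₂ (subst (_∈F 𝓕) (sym (swapOut-inverse x∉F y∈F)) F∈𝓕)

  Q-up⇒∈𝓕 : Q (up G) → x ∈ G → y ∉ G → G ∈F 𝓕
  Q-up⇒∈𝓕 Qup x∈G y∉G with Q⇒preimage Qup
  ... | inj₂ (_ , _ , _ , down≡up) = contradiction (subst (x ∈_) down≡up x∈down) x∉up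
  ... | inj₁ (_ , ¬moving)         =
    subst (_∈F 𝓕) (swapOut-inverse y∉G x∈G) (¬-not λ down∉𝓕 → ¬moving (x∉up , y∈up , down∉𝓕))

  ∈𝓕⇔Q-if-x∈⇔y∈ : (x ∈ G → y ∈ G) → (y ∈ G → x ∈ G) → G ∈F 𝓕 ⇔ Q G
  ∈𝓕⇔Q-if-x∈⇔y∈ {G = G} x⇒y y⇒x =
    mk⇔ (λ G∈𝓕 → fixed⇒Q G∈𝓕 λ (x∉G , y∈G , _) → x∉G (y⇒x y∈G)) (λ QG → Q⇒∈𝓕 QG x∉G⊎y∈G)
    where
    x∉G⊎y∈G : x ∉ G ⊎ y ∈ G
    x∉G⊎y∈G with x ∈? G
    ... | yes x∈G = inj₂ (x⇒y x∈G)
    ... | no  x∉G = inj₁ x∉G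

  record Ambiguous (H : Subset n) : Set where
    constructor ambiguous
    field
      inQ  : Q H
      ∋x   : x ∈ H
      ∌y   : y ∉ H
      up∉Q : ¬ Q (up H)

  moving∈𝓕⇒Ambiguous-down : F ∈F 𝓕 → Moving F → Ambiguous (down F)
  moving∈𝓕⇒Ambiguous-down F∈𝓕 moving@(x∉F , y∈F , _) = ambiguous (∈𝓕⇒Q-down F∈𝓕 x∉F y∈F) x∈down y∉down
    (subst (¬_ ∘ Q) (sym (swapOut-inverse x∉F y∈F)) (moving⇒¬Q moving))

  Constant : Bool → Set
  Constant b = ∀ {H} → Ambiguous H → 𝓕 H ≡ b

  Constant-true⇒𝓕≈Q : Constant true → ∀ G → G ∈F 𝓕 ⇔ Q G
  Constant-true⇒𝓕≈Q constant G = mk⇔ to from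
    where
    to : G ∈F 𝓕 → Q G
    to G∈𝓕 with moving? G
    ... | no  ¬moving = fixed⇒Q G∈𝓕 ¬moving
    ... | yes moving  = ⊥-elim (not-¬ (constant (moving∈𝓕⇒Ambiguous-down G∈𝓕 moving)) (proj₂ (proj₂ moving)))
    from : Q G → G ∈F 𝓕
    from QG with x ∈? G | y ∈? G
    ... | no  x∉G | _       = Q⇒∈𝓕 QG (inj₁ x∉G)
    ... | _       | yes y∈G = Q⇒∈𝓕 QG (inj₂ y∈G)
    ... | yes x∈G | no  y∉G with 𝓕 G in G∈?𝓕
    ...   | true  = refl
    ...   | false = ⊥-elim (not-¬ (constant (ambiguous QG x∈G y∉G ¬Q-up)) G∈?𝓕)
      where
      ¬Q-up : ¬ Q (up G)
      ¬Q-up Qup = not-¬ (Q-up⇒∈𝓕 Qup x∈G y∉G) G∈?𝓕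

  Constant-false⇒down∈𝓕⇔Q : Constant false → x ∉ G → y ∈ G → down G ∈F 𝓕 ⇔ Q G
  Constant-false⇒down∈𝓕⇔Q {G = G} constant x∉G y∈G = mk⇔ to from
    where
    to : down G ∈F 𝓕 → Q G
    to down∈𝓕 with 𝓕 G in G∈?𝓕
    ... | true  = fixed⇒Q G∈?𝓕 λ (_ , _ , down∉𝓕) → not-¬ down∈𝓕 down∉𝓕
    ... | false = ⊥-elim (not-¬ down∈𝓕 (constant (ambiguous Q-down x∈down y∉down ¬Q-up-down)))
      where
      Q-down : Q (down G)
      Q-down = fixed⇒Q down∈𝓕 λ (x∉down , _) → x∉down x∈down
      ¬Q-up-down : ¬ Q (up (down G))
      ¬Q-up-down Q-up-down = not-¬ (Q⇒∈𝓕 (subst Q (swapOut-inverse x∉G y∈G) Q-up-down) (inj₂ y∈G)) G∈?𝓕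
    from : Q G → down G ∈F 𝓕
    from QG = ¬-not λ down∉𝓕 → moving⇒¬Q (x∉G , y∈G , down∉𝓕) QG

  Constant-false⇒up∈𝓕⇔Q : Constant false → x ∈ G → y ∉ G → up G ∈F 𝓕 ⇔ Q G
  Constant-false⇒up∈𝓕⇔Q {G = G} constant x∈G y∉G = mk⇔ to from
    where
    to : up G ∈F 𝓕 → Q G
    to up∈𝓕 = subst Q (swapOut-inverse y∉G x∈G) (∈𝓕⇒Q-down up∈𝓕 x∉up y∈up)
    from : Q G → up G ∈F 𝓕
    from QG with Q⇒∈𝓕⊎up∈𝓕 QG
    ... | inj₂ up∈𝓕 = up∈𝓕
    ... | inj₁ G∈𝓕  with 𝓕 (up G) in up∈?𝓕
    ...   | true  = refl
    ...   | false = ⊥-elim (not-¬ G∈𝓕 (constant (ambiguous QG x∈G y∉G ¬Q-up)))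
      where
      ¬Q-up : ¬ Q (up G)
      ¬Q-up Qup = not-¬ (Q⇒∈𝓕 Qup (inj₂ y∈up)) up∈?𝓕

  private
    via-τ : permSet (transpose x y) G ≡ H → H ∈F 𝓕 ⇔ Q G → permSet (transpose x y) G ∈F 𝓕 ⇔ Q G
    via-τ {G = G} τG≡H = subst (λ H → H ∈F 𝓕 ⇔ Q G) (sym τG≡H)

  Constant-false⇒τ𝓕≈Q : Constant false → ∀ G → permSet (transpose x y) G ∈F 𝓕 ⇔ Q G
  Constant-false⇒τ𝓕≈Q constant G with x ∈? G | y ∈? G
  ... | yes x∈G | yes y∈G = via-τ (permSet-transpose-fixes x≢y G x⇒y y⇒x) (∈𝓕⇔Q-if-x∈⇔y∈ x⇒y y⇒x)
    where
    x⇒y : x ∈ G → y ∈ G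
    x⇒y _ = y∈G
    y⇒x : y ∈ G → x ∈ G
    y⇒x _ = x∈G
  ... | no  x∉G | no  y∉G = via-τ (permSet-transpose-fixes x≢y G x⇒y y⇒x) (∈𝓕⇔Q-if-x∈⇔y∈ x⇒y y⇒x)
    where
    x⇒y : x ∈ G → y ∈ G
    x⇒y x∈G = contradiction x∈G x∉G
    y⇒x : y ∈ G → x ∈ G
    y⇒x y∈G = contradiction y∈G y∉G
  ... | no  x∉G | yes y∈G =
    via-τ (permSet-transpose-down x≢y G x∉G y∈G) (Constant-false⇒down∈𝓕⇔Q constant x∉G y∈G)
  ... | yes x∈G | no  y∉G =
    via-τ (permSet-transpose-up x≢y G x∈G y∉G) (Constant-false⇒up∈𝓕⇔Q constant x∈G y∉G)

  Constant⇒permuted : Σ Bool Constant → Σ (Permutation′ n) λ σ → ∀ G → G ∈Perm[ 𝓕 , σ ] ⇔ Q G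
  Constant⇒permuted (true , constant) = idₚ , involutive⇒∈Perm⇔ 𝓕 idₚ
    (λ G → trans (tabulate∘lookup _) (tabulate∘lookup G))
    (λ G → subst (λ H → H ∈F 𝓕 ⇔ Q G) (sym (tabulate∘lookup G)) (Constant-true⇒𝓕≈Q constant G))
  Constant⇒permuted (false , constant) = transpose x y , involutive⇒∈Perm⇔ 𝓕 (transpose x y)
    (permSet-transpose-involutive x≢y) (Constant-false⇒τ𝓕≈Q constant)

  module _ (intersecting : Intersecting 𝓕) where

    private
      Ambiguous-∈𝓕-transfer : Ambiguous G → Ambiguous H → G ∩ H ⊆ ⁅ x ⁆ → G ∈F 𝓕 → H ∈F 𝓕
      Ambiguous-∈𝓕-transfer {G = G} {H = H} ambG ambH G∩H⊆x G∈𝓕 with 𝓕 H in H∈?𝓕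
      ... | true  = refl
      ... | false with Q⇒∈𝓕⊎up∈𝓕 (Ambiguous.inQ ambH)
      ...   | inj₁ H∈𝓕  = ⊥-elim (not-¬ H∈𝓕 H∈?𝓕)
      ...   | inj₂ up∈𝓕 with intersecting G (up H) G∈𝓕 up∈𝓕
      ...     | z , z∈G∩up with x∈p∩q⁻ G (up H) z∈G∩up
      ...       | z∈G , z∈up with ∈up⁻ z∈up
      ...         | inj₁ refl        = ⊥-elim (Ambiguous.∌y ambG z∈G)
      ...         | inj₂ (z≢x , z∈H) = ⊥-elim (z≢x (x∈⁅y⁆⇒x≡y x (G∩H⊆x (x∈p∩q⁺ (z∈G , z∈H)))))

    Ambiguous-agree : Ambiguous G → Ambiguous H → G ∩ H ⊆ ⁅ x ⁆ → 𝓕 G ≡ 𝓕 H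
    Ambiguous-agree {G = G} {H = H} ambG ambH G∩H⊆x with 𝓕 G in G∈?𝓕 | 𝓕 H in H∈?𝓕
    ... | true  | true  = refl
    ... | false | false = refl
    ... | true  | false = ⊥-elim (not-¬ (Ambiguous-∈𝓕-transfer ambG ambH G∩H⊆x G∈?𝓕) H∈?𝓕)
    ... | false | true  = ⊥-elim (not-¬ (Ambiguous-∈𝓕-transfer ambH ambG H∩G⊆x H∈?𝓕) G∈?𝓕)
      where
      H∩G⊆x : H ∩ G ⊆ ⁅ x ⁆
      H∩G⊆x = subst (_⊆ ⁅ x ⁆) (∩-comm G H) G∩H⊆x

    Ambiguous-link : ∀ {C} → Ambiguous C → Ambiguous G → Ambiguous H → C ∩ G ⊆ ⁅ x ⁆ → C ∩ H ⊆ ⁅ x ⁆ →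
                     𝓕 G ≡ 𝓕 H
    Ambiguous-link ambC ambG ambH C∩G⊆x C∩H⊆x =
      trans (sym (Ambiguous-agree ambC ambG C∩G⊆x)) (Ambiguous-agree ambC ambH C∩H⊆x)

-- Shifts onto 𝒥₃

module J3Shift (k : ℕ) {n : ℕ} (4≤k : 4 ≤ k) (2k+1≤n : 2 * k + 1 ≤ n)
               (𝓕 : Family n) (intersecting : Intersecting 𝓕) {x y : Fin n} (x≢y : x ≢ y)
               {E : Subset n} {x₀ : Fin n} {J : Subset n} (params : J3Params k E x₀ J)
               (shift≈J3 : ∀ G → G ∈Shift[ 𝓕 , x , y ] ⇔ InJ3 k E x₀ J G) where

  open ShiftedOnto 𝓕 x≢y (InJ3 k E x₀ J) shift≈J3 public

  Shape : Subset n → Set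
  Shape G = (E ⊆ G × Nonempty (G ∩ J)) ⊎ (J ∪ ⁅ x₀ ⁆ ⊆ G) ⊎ (x₀ ∈ G × Nonempty (G ∩ E))

  ∣E∣≡k∸1 : ∣ E ∣ ≡ k ∸ 1
  ∣E∣≡k∸1 = proj₁ params

  x₀∉E : x₀ ∉ E
  x₀∉E = proj₁ (proj₂ params)

  ∣J∣≡3 : ∣ J ∣ ≡ 3
  ∣J∣≡3 = proj₁ (proj₂ (proj₂ params))

  ∈J⇒∉E : i ∈ J → i ∉ E
  ∈J⇒∉E i∈J i∈E = proj₂ (proj₂ (proj₂ params)) (_ , x∈p∩q⁺ (i∈J , p⊆p∪q ⁅ x₀ ⁆ i∈E))

  ∈J⇒≢x₀ : i ∈ J → i ≢ x₀
  ∈J⇒≢x₀ i∈J refl = proj₂ (proj₂ (proj₂ params)) (_ , x∈p∩q⁺ (i∈J , q⊆p∪q E ⁅ x₀ ⁆ (x∈⁅x⁆ _)))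

  1+∣E∣≡k : suc ∣ E ∣ ≡ k
  1+∣E∣≡k = trans (cong suc ∣E∣≡k∸1) (m+[n∸m]≡n (≤-trans (s≤s z≤n) 4≤k))

  3≤∣E∣ : 3 ≤ ∣ E ∣
  3≤∣E∣ = subst (3 ≤_) (sym ∣E∣≡k∸1) (∸-monoˡ-≤ 1 4≤k)

  2≤k : 2 ≤ k
  2≤k = ≤-trans (s≤s (s≤s z≤n)) 4≤k

  k+1+k≤n : k + suc k ≤ n
  k+1+k≤n = ≤-trans (≤-reflexive k+1+k≡2k+1) 2k+1≤n
    where
    k+1+k≡2k+1 : k + suc k ≡ 2 * k + 1
    k+1+k≡2k+1 rewrite +-suc k k | +-identityʳ k = +-comm 1 (k + k)

  ∣⁅x⁆∪⁅y⁆∣≤k : ∀ (i j : Fin n) → ∣ ⁅ i ⁆ ∪ ⁅ j ⁆ ∣ ≤ k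
  ∣⁅x⁆∪⁅y⁆∣≤k i j = ≤-trans (∣⁅x⁆∪⁅y⁆∣≤2 i j) 2≤k

  ∈E∪⁅j⁆⁻ : i ∈ E ∪ ⁅ j ⁆ → i ∈ E ⊎ i ≡ j
  ∈E∪⁅j⁆⁻ {j = j} i∈ with x∈p∪q⁻ E ⁅ j ⁆ i∈
  ... | inj₁ i∈E   = inj₁ i∈E
  ... | inj₂ i∈⁅j⁆ = inj₂ (x∈⁅y⁆⇒x≡y j i∈⁅j⁆)

  j∈E∪⁅j⁆ : ∀ j → j ∈ E ∪ ⁅ j ⁆
  j∈E∪⁅j⁆ j = q⊆p∪q E ⁅ j ⁆ (x∈⁅x⁆ j)

  ∣E∪⁅j⁆∣≡k : j ∉ E → ∣ E ∪ ⁅ j ⁆ ∣ ≡ k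
  ∣E∪⁅j⁆∣≡k {j = j} j∉E = begin
    ∣ E ∪ ⁅ j ⁆ ∣       ≡⟨ ∣p∪q∣≡∣p∣+∣q∣ E ⁅ j ⁆ (Disjoint-sym (Disjoint-⁅x⁆ j∉E)) ⟩
    ∣ E ∣ + ∣ ⁅ j ⁆ ∣   ≡⟨ cong (∣ E ∣ +_) (∣⁅x⁆∣≡1 j) ⟩
    ∣ E ∣ + 1           ≡⟨ +-comm ∣ E ∣ 1 ⟩
    suc ∣ E ∣           ≡⟨ 1+∣E∣≡k ⟩
    k                   ∎
    where open ≡-Reasoning

  E⊆H⇒H≡E∪⁅j⁆ : E ⊆ H → j ∈ H → j ∉ E → ∣ H ∣ ≡ k → H ≡ E ∪ ⁅ j ⁆
  E⊆H⇒H≡E∪⁅j⁆ {H = H} {j = j} E⊆H j∈H j∉E ∣H∣≡k =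
    sym (p⊆q∧∣p∣≡∣q∣⇒p≡q E∪⁅j⁆⊆H (trans (∣E∪⁅j⁆∣≡k j∉E) (sym ∣H∣≡k)))
    where
    E∪⁅j⁆⊆H : E ∪ ⁅ j ⁆ ⊆ H
    E∪⁅j⁆⊆H = p⊆r∧q⊆r⇒p∪q⊆r E⊆H λ i∈⁅j⁆ → subst (_∈ H) (sym (x∈⁅y⁆⇒x≡y j i∈⁅j⁆)) j∈H

  ∩E⊆⁅x⁆⇒∩E∪⁅j⁆⊆⁅x⁆ : H ∩ E ⊆ ⁅ x ⁆ → (j ∈ H → j ≡ x) → H ∩ (E ∪ ⁅ j ⁆) ⊆ ⁅ x ⁆
  ∩E⊆⁅x⁆⇒∩E∪⁅j⁆⊆⁅x⁆ {H = H} H∩E⊆x j∈H⇒j≡x i∈ with x∈p∩q⁻ H _ i∈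
  ... | i∈H , i∈E∪⁅j⁆ with ∈E∪⁅j⁆⁻ i∈E∪⁅j⁆
  ...   | inj₁ i∈E  = H∩E⊆x (x∈p∩q⁺ (i∈H , i∈E))
  ...   | inj₂ refl rewrite j∈H⇒j≡x i∈H = x∈⁅x⁆ x

  Shape-cases : Shape H → (E ⊆ H × Nonempty (H ∩ J)) ⊎ x₀ ∈ H
  Shape-cases (inj₁ E⊆H∧H∩J≢∅)         = inj₁ E⊆H∧H∩J≢∅
  Shape-cases (inj₂ (inj₁ J∪⁅x₀⁆⊆H))   = inj₂ (J∪⁅x₀⁆⊆H (q⊆p∪q J ⁅ x₀ ⁆ (x∈⁅x⁆ x₀)))
  Shape-cases (inj₂ (inj₂ (x₀∈H , _))) = inj₂ x₀∈H

  Shape∧x₀∉ : Shape H → x₀ ∉ H → E ⊆ H × Nonempty (H ∩ J)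
  Shape∧x₀∉ shape x₀∉H with Shape-cases shape
  ... | inj₁ E⊆H∧H∩J≢∅ = E⊆H∧H∩J≢∅
  ... | inj₂ x₀∈H      = contradiction x₀∈H x₀∉H

  Ambiguous⇒¬Shape-up : Ambiguous H → ¬ Shape (up H)
  Ambiguous⇒¬Shape-up amb shape = up∉Q (trans (∣up∣ ∋x ∌y) (proj₁ inQ) , shape)
    where open Ambiguous amb

  Ambiguous∧x₀∈⇒∩E⊆⁅x⁆ : x ≢ x₀ → Ambiguous H → x₀ ∈ H → H ∩ E ⊆ ⁅ x ⁆
  Ambiguous∧x₀∈⇒∩E⊆⁅x⁆ x≢x₀ amb x₀∈H {i} i∈H∩E with x∈p∩q⁻ _ E i∈H∩E | i ≟ x
  ... | _         | yes refl = x∈⁅x⁆ i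
  ... | i∈H , i∈E | no  i≢x  = contradiction
    (inj₂ (inj₂ (up-keeps (x≢x₀ ∘ sym) x₀∈H , i , x∈p∩q⁺ (up-keeps i≢x i∈H , i∈E))))
    (Ambiguous⇒¬Shape-up amb)

  partner : ∀ {S} (A B : Subset n) → ∣ S ∣ ≡ k → x ∈ S → ∣ A ∣ ≤ k → ∣ B ∣ ≤ 2 →
            Disjoint A ((S - x) ∪ B) → Extension k A ((S - x) ∪ B)
  partner {S} A B ∣S∣≡k x∈S ∣A∣≤k ∣B∣≤2 A# = extend k A ((S - x) ∪ B) A# ∣A∣≤k (begin
    k + ∣ (S - x) ∪ B ∣      ≤⟨ +-monoʳ-≤ k (∣p∪q∣≤∣p∣+∣q∣ (S - x) B) ⟩
    k + (∣ S - x ∣ + ∣ B ∣)  ≤⟨ +-monoʳ-≤ k (+-monoʳ-≤ ∣ S - x ∣ ∣B∣≤2) ⟩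
    k + (∣ S - x ∣ + 2)      ≡⟨ cong (k +_) (+-comm ∣ S - x ∣ 2) ⟩
    k + suc (suc ∣ S - x ∣)  ≤⟨ +-monoʳ-≤ k (s≤s (subst (suc ∣ S - x ∣ ≤_) ∣S∣≡k (x∈p⇒∣p-x∣<∣p∣ x∈S))) ⟩
    k + suc k                ≤⟨ k+1+k≤n ⟩
    n                        ∎)
    where open ≤-Reasoning

  no-Ambiguous-if-y∈E : x ≢ x₀ → y ∈ E → ¬ Ambiguous H
  no-Ambiguous-if-y∈E x≢x₀ y∈E amb with Shape-cases (proj₂ (Ambiguous.inQ amb))
  ... | inj₁ (E⊆H , _) = Ambiguous.∌y amb (E⊆H y∈E)
  ... | inj₂ x₀∈H      = Ambiguous⇒¬Shape-up amb
    (inj₂ (inj₂ (up-keeps (x≢x₀ ∘ sym) x₀∈H , y , x∈p∩q⁺ (y∈up , y∈E))))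

  no-Ambiguous-if-y≡x₀ : y ≡ x₀ → ¬ Ambiguous H
  no-Ambiguous-if-y≡x₀ {H = H} y≡x₀ amb with 2≤∣p∣⇒∃x∈p∧x≢y E x (≤-trans (s≤s (s≤s z≤n)) 3≤∣E∣)
  ... | e , e∈E , e≢x = Ambiguous⇒¬Shape-up amb
    (inj₂ (inj₂ (subst (_∈ up H) y≡x₀ y∈up , e , x∈p∩q⁺ (up-keeps e≢x (E⊆H e∈E) , e∈E))))
    where
    open Ambiguous amb
    E⊆H : E ⊆ H
    E⊆H = proj₁ (Shape∧x₀∉ (proj₂ inQ) λ x₀∈H → ∌y (subst (_∈ H) (sym y≡x₀) x₀∈H))

  no-Ambiguous-if-x∉E∪⁅x₀⁆ : x ∉ E → x ≢ x₀ → (x ∈ J → y ∈ J) → ¬ Ambiguous H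
  no-Ambiguous-if-x∉E∪⁅x₀⁆ {H = H} x∉E x≢x₀ x∈J⇒y∈J amb = Ambiguous⇒¬Shape-up amb (Shape-up (proj₂ inQ))
    where
    open Ambiguous amb
    ∈E⇒≢x : i ∈ E → i ≢ x
    ∈E⇒≢x i∈E refl = x∉E i∈E
    E⊆up : E ⊆ H → E ⊆ up H
    E⊆up E⊆H i∈E = up-keeps (∈E⇒≢x i∈E) (E⊆H i∈E)
    ∈J∪⁅x₀⁆⇒≢x : J ∪ ⁅ x₀ ⁆ ⊆ H → i ∈ J ∪ ⁅ x₀ ⁆ → i ≢ x
    ∈J∪⁅x₀⁆⇒≢x J∪⁅x₀⁆⊆H x∈J∪⁅x₀⁆ refl with x∈p∪q⁻ J ⁅ x₀ ⁆ x∈J∪⁅x₀⁆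
    ... | inj₁ x∈J    = ∌y (J∪⁅x₀⁆⊆H (p⊆p∪q ⁅ x₀ ⁆ (x∈J⇒y∈J x∈J)))
    ... | inj₂ x∈⁅x₀⁆ = x≢x₀ (x∈⁅y⁆⇒x≡y x₀ x∈⁅x₀⁆)
    Shape-up : Shape H → Shape (up H)
    Shape-up (inj₁ (E⊆H , j , j∈H∩J)) with x∈p∩q⁻ H J j∈H∩J | j ≟ x
    ... | _   , j∈J | yes refl = inj₁ (E⊆up E⊆H , y , x∈p∩q⁺ (y∈up , x∈J⇒y∈J j∈J))
    ... | j∈H , j∈J | no  j≢x  = inj₁ (E⊆up E⊆H , j , x∈p∩q⁺ (up-keeps j≢x j∈H , j∈J))
    Shape-up (inj₂ (inj₁ J∪⁅x₀⁆⊆H)) =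
      inj₂ (inj₁ λ i∈ → up-keeps (∈J∪⁅x₀⁆⇒≢x J∪⁅x₀⁆⊆H i∈) (J∪⁅x₀⁆⊆H i∈))
    Shape-up (inj₂ (inj₂ (x₀∈H , e , e∈H∩E))) with x∈p∩q⁻ H E e∈H∩E
    ... | e∈H , e∈E =
      inj₂ (inj₂ (up-keeps (x≢x₀ ∘ sym) x₀∈H , e , x∈p∩q⁺ (up-keeps (∈E⇒≢x e∈E) e∈H , e∈E)))

  module x∈J-Case (x∈J : x ∈ J) (y∉E : y ∉ E) (y≢x₀ : y ≢ x₀) (y∉J : y ∉ J) where

    x∉E : x ∉ E
    x∉E = ∈J⇒∉E x∈J

    T : Subset n
    T = E ∪ ⁅ x ⁆

    x₀∉up-T : x₀ ∉ up T
    x₀∉up-T x₀∈ with ∈up⁻ x₀∈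
    ... | inj₁ x₀≡y          = y≢x₀ (sym x₀≡y)
    ... | inj₂ (x₀≢x , x₀∈T) = [ x₀∉E , x₀≢x ]′ (∈E∪⁅j⁆⁻ x₀∈T)

    up-T∩J-empty : Empty (up T ∩ J)
    up-T∩J-empty (j , j∈up∩J) with x∈p∩q⁻ _ J j∈up∩J
    ... | j∈up , j∈J with ∈up⁻ j∈up
    ...   | inj₁ refl        = y∉J j∈J
    ...   | inj₂ (j≢x , j∈T) = [ ∈J⇒∉E j∈J , j≢x ]′ (∈E∪⁅j⁆⁻ j∈T)

    T-ambiguous : Ambiguous T
    T-ambiguous = ambiguous
      (∣E∪⁅j⁆∣≡k x∉E , inj₁ (p⊆p∪q ⁅ x ⁆ , x , x∈p∩q⁺ (j∈E∪⁅j⁆ x , x∈J)))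
      (j∈E∪⁅j⁆ x)
      (λ y∈T → [ y∉E , x≢y ∘ sym ]′ (∈E∪⁅j⁆⁻ y∈T))
      (λ (_ , shape) → [ up-T∩J-empty ∘ proj₂ , x₀∉up-T ]′ (Shape-cases shape))

    constant : Σ Bool Constant
    constant = 𝓕 T , agree
      where
      agree : Constant (𝓕 T)
      agree {H} amb with x₀ ∈? H
      ... | yes x₀∈H = Ambiguous-agree intersecting amb T-ambiguous
        (∩E⊆⁅x⁆⇒∩E∪⁅j⁆⊆⁅x⁆ (Ambiguous∧x₀∈⇒∩E⊆⁅x⁆ (∈J⇒≢x₀ x∈J) amb x₀∈H) (λ _ → refl))
      ... | no  x₀∉H = cong 𝓕 (E⊆H⇒H≡E∪⁅j⁆ (proj₁ (Shape∧x₀∉ (proj₂ inQ) x₀∉H)) ∋x x∉E (proj₁ inQ))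
        where open Ambiguous amb

  module x∈E-Case (x∈E : x ∈ E) (y∉E : y ∉ E) (y≢x₀ : y ≢ x₀) where

    x≢x₀ : x ≢ x₀
    x≢x₀ x≡x₀ = x₀∉E (subst (_∈ E) x≡x₀ x∈E)

    ∈J⇒≢x : i ∈ J → i ≢ x
    ∈J⇒≢x i∈J refl = ∈J⇒∉E i∈J x∈E

    x∈E∪⁅j⁆ : ∀ j → x ∈ E ∪ ⁅ j ⁆
    x∈E∪⁅j⁆ j = p⊆p∪q ⁅ j ⁆ x∈E

    x₀∉E∪⁅j⁆ : j ∈ J → x₀ ∉ E ∪ ⁅ j ⁆
    x₀∉E∪⁅j⁆ j∈J = [ x₀∉E , ∈J⇒≢x₀ j∈J ∘ sym ]′ ∘ ∈E∪⁅j⁆⁻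

    T-ambiguous : j ∈ J → j ≢ y → Ambiguous (E ∪ ⁅ j ⁆)
    T-ambiguous {j = j} j∈J j≢y = ambiguous
      (∣E∪⁅j⁆∣≡k (∈J⇒∉E j∈J) , inj₁ (p⊆p∪q ⁅ j ⁆ , j , x∈p∩q⁺ (j∈E∪⁅j⁆ j , j∈J)))
      (x∈E∪⁅j⁆ j)
      (λ y∈T → [ y∉E , j≢y ∘ sym ]′ (∈E∪⁅j⁆⁻ y∈T))
      (λ (_ , shape) → [ (λ (E⊆up , _) → x∉up (E⊆up x∈E)) , x₀∉up-T ]′ (Shape-cases shape))
      where
      x₀∉up-T : x₀ ∉ up (E ∪ ⁅ j ⁆)
      x₀∉up-T = ∉up (y≢x₀ ∘ sym) (x₀∉E∪⁅j⁆ j∈J)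

    avoiding-T-x⇒¬Shape-up : ∀ {C j} → j ∈ J → j ≢ y → Disjoint C ((E ∪ ⁅ j ⁆) - x) → ¬ Shape (up C)
    avoiding-T-x⇒¬Shape-up j∈J j≢y C# (inj₁ (E⊆up , _)) = x∉up (E⊆up x∈E)
    avoiding-T-x⇒¬Shape-up {j = j} j∈J j≢y C# (inj₂ (inj₁ J∪⁅x₀⁆⊆up)) with ∈up⁻ (J∪⁅x₀⁆⊆up (p⊆p∪q ⁅ x₀ ⁆ j∈J))
    ... | inj₁ j≡y         = j≢y j≡y
    ... | inj₂ (j≢x , j∈C) = C# j∈C (x∈p∧x≢y⇒x∈p-y (j∈E∪⁅j⁆ j) j≢x)
    avoiding-T-x⇒¬Shape-up {j = j} j∈J j≢y C# (inj₂ (inj₂ (_ , e , e∈up∩E))) with x∈p∩q⁻ _ E e∈up∩E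
    ... | e∈up , e∈E with ∈up⁻ e∈up
    ...   | inj₁ refl        = y∉E e∈E
    ...   | inj₂ (e≢x , e∈C) = C# e∈C (x∈p∧x≢y⇒x∈p-y (p⊆p∪q ⁅ j ⁆ e∈E) e≢x)

    T-agree : ∀ {j j′} → j ∈ J → j ≢ y → j′ ∈ J → j′ ≢ y → 𝓕 (E ∪ ⁅ j ⁆) ≡ 𝓕 (E ∪ ⁅ j′ ⁆)
    T-agree {j} {j′} j∈J j≢y j′∈J j′≢y =
      Ambiguous-link intersecting C-ambiguous (T-ambiguous j∈J j≢y) (T-ambiguous j′∈J j′≢y)
        (Disjoint-[p-x]∪q⇒∩⊆⁅x⁆ avoids)
        (∩E⊆⁅x⁆⇒∩E∪⁅j⁆⊆⁅x⁆ C∩E⊆⁅x⁆ λ j′∈C → contradiction (x∈⁅x⁆∪⁅y⁆ j′ y) (Disjoint-∪ʳ avoids j′∈C))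
      where
      open Extension (partner {S = E ∪ ⁅ j ⁆} (⁅ x₀ ⁆ ∪ ⁅ x ⁆) (⁅ j′ ⁆ ∪ ⁅ y ⁆)
        (∣E∪⁅j⁆∣≡k (∈J⇒∉E j∈J)) (x∈E∪⁅j⁆ j)
        (∣⁅x⁆∪⁅y⁆∣≤k x₀ x) (∣⁅x⁆∪⁅y⁆∣≤2 j′ y)
        (Disjoint-⁅x⁆∪⁅y⁆
          (x∉p∧x∉q⇒x∉p∪q (x∉p⇒x∉p-y (x₀∉E∪⁅j⁆ j∈J)) (x∉⁅y⁆∪⁅z⁆ (∈J⇒≢x₀ j′∈J ∘ sym) (y≢x₀ ∘ sym)))
          (x∉p∧x∉q⇒x∉p∪q (x∉p-x _ x) (x∉⁅y⁆∪⁅z⁆ (∈J⇒≢x j′∈J ∘ sym) x≢y))))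
        renaming (set to C)
      C∩E⊆⁅x⁆ : C ∩ E ⊆ ⁅ x ⁆
      C∩E⊆⁅x⁆ = Disjoint-p-x⇒∩⊆⁅x⁆ λ i∈C i∈E-x →
        Disjoint-∪ˡ avoids i∈C (x∈p∧x≢y⇒x∈p-y (p⊆p∪q ⁅ j ⁆ (p─q⊆p E ⁅ x ⁆ i∈E-x)) (x∈p-y⇒x≢y i∈E-x))
      C-ambiguous : Ambiguous C
      C-ambiguous = ambiguous
        (size , inj₂ (inj₂ (⊇A (x∈⁅x⁆∪⁅y⁆ x₀ x) , x , x∈p∩q⁺ (⊇A (y∈⁅x⁆∪⁅y⁆ x₀ x) , x∈E))))
        (⊇A (y∈⁅x⁆∪⁅y⁆ x₀ x))
        (λ y∈C → Disjoint-∪ʳ avoids y∈C (y∈⁅x⁆∪⁅y⁆ j′ y))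
        (λ (_ , shape) → avoiding-T-x⇒¬Shape-up j∈J j≢y (Disjoint-∪ˡ avoids) shape)

    j₁∈J×j₁≢y : ∃ λ j → j ∈ J × j ≢ y
    j₁∈J×j₁≢y = 2≤∣p∣⇒∃x∈p∧x≢y J y (subst (2 ≤_) (sym ∣J∣≡3) (s≤s (s≤s z≤n)))

    j₁ : Fin n
    j₁ = proj₁ j₁∈J×j₁≢y

    T₁-agree : j ∈ J → j ≢ y → 𝓕 (E ∪ ⁅ j ⁆) ≡ 𝓕 (E ∪ ⁅ j₁ ⁆)
    T₁-agree j∈J j≢y = T-agree j∈J j≢y (proj₁ (proj₂ j₁∈J×j₁≢y)) (proj₂ (proj₂ j₁∈J×j₁≢y))

    x₀∈⇒∃J∖up : Ambiguous H → x₀ ∈ H → ∃ λ j → j ∈ J × j ∉ up H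
    x₀∈⇒∃J∖up {H = H} amb x₀∈H with p⊈q⇒∃x∈p∖q (J ∪ ⁅ x₀ ⁆) (up H) (Ambiguous⇒¬Shape-up amb ∘ inj₂ ∘ inj₁)
    ... | j , j∈J∪⁅x₀⁆ , j∉up with x∈p∪q⁻ J ⁅ x₀ ⁆ j∈J∪⁅x₀⁆
    ...   | inj₁ j∈J    = j , j∈J , j∉up
    ...   | inj₂ j∈⁅x₀⁆ rewrite x∈⁅y⁆⇒x≡y x₀ j∈⁅x₀⁆ = contradiction (up-keeps (x≢x₀ ∘ sym) x₀∈H) j∉up

    constant : Σ Bool Constant
    constant = 𝓕 (E ∪ ⁅ j₁ ⁆) , agree
      where
      agree : Constant (𝓕 (E ∪ ⁅ j₁ ⁆))
      agree {H} amb with x₀ ∈? H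
      ... | no  x₀∉H with Shape∧x₀∉ (proj₂ (Ambiguous.inQ amb)) x₀∉H
      ...   | E⊆H , j , j∈H∩J with x∈p∩q⁻ H J j∈H∩J
      ...     | j∈H , j∈J = trans (cong 𝓕 (E⊆H⇒H≡E∪⁅j⁆ E⊆H j∈H (∈J⇒∉E j∈J) (proj₁ (Ambiguous.inQ amb))))
                                  (T₁-agree j∈J λ { refl → Ambiguous.∌y amb j∈H })
      agree {H} amb | yes x₀∈H with x₀∈⇒∃J∖up amb x₀∈H
      ...   | j , j∈J , j∉up = trans (Ambiguous-agree intersecting amb (T-ambiguous j∈J j≢y) H∩T⊆⁅x⁆)
                                     (T₁-agree j∈J j≢y)
        where
        j≢y : j ≢ y
        j≢y refl = j∉up y∈up
        H∩T⊆⁅x⁆ : H ∩ (E ∪ ⁅ j ⁆) ⊆ ⁅ x ⁆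
        H∩T⊆⁅x⁆ = ∩E⊆⁅x⁆⇒∩E∪⁅j⁆⊆⁅x⁆ (Ambiguous∧x₀∈⇒∩E⊆⁅x⁆ x≢x₀ amb x₀∈H)
                    (λ j∈H → contradiction (up-keeps (∈J⇒≢x j∈J) j∈H) j∉up)

  module x≡x₀-Case (x≡x₀ : x ≡ x₀) where

    x∉E : x ∉ E
    x∉E = subst (_∉ E) (sym x≡x₀) x₀∉E

    x∉J : x ∉ J
    x∉J x∈J = ∈J⇒≢x₀ x∈J x≡x₀

    ∈E∧∉up⇒¬Shape-up : ∀ {e} → e ∈ E → e ∉ up G → ¬ Shape (up G)
    ∈E∧∉up⇒¬Shape-up {G = G} e∈E e∉up shape with Shape-cases shape
    ... | inj₁ (E⊆up , _) = e∉up (E⊆up e∈E)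
    ... | inj₂ x₀∈up      = x∉up (subst (_∈ up G) (sym x≡x₀) x₀∈up)

    E* : Subset n
    E* = E - y

    E*⊆E : i ∈ E* → i ∈ E
    E*⊆E = p─q⊆p E ⁅ y ⁆

    ∈E*⇒≢y : i ∈ E* → i ≢ y
    ∈E*⇒≢y = x∈p-y⇒x≢y

    ∈E*⇒≢x : i ∈ E* → i ≢ x
    ∈E*⇒≢x i∈E* refl = x∉E (E*⊆E i∈E*)

    ∃E*∖⁅j⁆ : ∀ j → ∃ λ e → e ∈ E* × e ≢ j
    ∃E*∖⁅j⁆ j = 2≤∣p∣⇒∃x∈p∧x≢y E* j (≤-pred (≤-trans 3≤∣E∣ (∣p∣≤1+∣p-x∣ E y)))

    record Straddling (H : Subset n) : Set where
      field
        size   : ∣ H ∣ ≡ k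
        ∋x     : x ∈ H
        ∌y     : y ∉ H
        meets  : ∃ λ e → e ∈ E* × e ∈ H
        misses : ∃ λ e → e ∈ E* × e ∉ H

    Straddling⇒Ambiguous : Straddling G → Ambiguous G
    Straddling⇒Ambiguous {G = G} straddling with Straddling.meets straddling | Straddling.misses straddling
    ... | e , e∈E* , e∈G | e′ , e′∈E* , e′∉G = ambiguous
      (size , inj₂ (inj₂ (subst (_∈ G) x≡x₀ ∋x , e , x∈p∩q⁺ (e∈G , E*⊆E e∈E*))))
      ∋x ∌y (λ (_ , shape) → ∈E∧∉up⇒¬Shape-up (E*⊆E e′∈E*) (∉up (∈E*⇒≢y e′∈E*) e′∉G) shape)
      where open Straddling straddling

    record StraddlingPartner (S : Subset n) (e′ b : Fin n) : Set where
      field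
        set        : Subset n
        straddling : Straddling set
        ∋e′        : e′ ∈ set
        ∌b         : b ∉ set
        ∩S⊆⁅x⁆     : set ∩ S ⊆ ⁅ x ⁆

    straddling-partner : ∀ {S e′ m} b → ∣ S ∣ ≡ k → x ∈ S → e′ ∈ E* → e′ ∉ S → b ∉ S → b ≢ e′ →
                         m ∈ E* → m ∈ (S - x) ∪ ⁅ b ⁆ → StraddlingPartner S e′ b
    straddling-partner {S} {e′} {m} b ∣S∣≡k x∈S e′∈E* e′∉S b∉S b≢e′ m∈E* m∈S-x∪⁅b⁆ = record
      { set        = C
      ; straddling = record
        { size   = size
        ; ∋x     = ⊇A (x∈⁅x⁆∪⁅y⁆ x e′)
        ; ∌y     = λ y∈C → Disjoint-∪ʳ avoids y∈C (y∈⁅x⁆∪⁅y⁆ b y)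
        ; meets  = e′ , e′∈E* , ⊇A (y∈⁅x⁆∪⁅y⁆ x e′)
        ; misses = m , m∈E* , m∉C
        }
      ; ∋e′        = ⊇A (y∈⁅x⁆∪⁅y⁆ x e′)
      ; ∌b         = λ b∈C → Disjoint-∪ʳ avoids b∈C (x∈⁅x⁆∪⁅y⁆ b y)
      ; ∩S⊆⁅x⁆     = Disjoint-[p-x]∪q⇒∩⊆⁅x⁆ avoids
      }
      where
      x≢b : x ≢ b
      x≢b refl = b∉S x∈S
      open Extension (partner {S = S} (⁅ x ⁆ ∪ ⁅ e′ ⁆) (⁅ b ⁆ ∪ ⁅ y ⁆) ∣S∣≡k x∈S
        (∣⁅x⁆∪⁅y⁆∣≤k x e′) (∣⁅x⁆∪⁅y⁆∣≤2 b y)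
        (Disjoint-⁅x⁆∪⁅y⁆ (x∉p∧x∉q⇒x∉p∪q (x∉p-x S x) (x∉⁅y⁆∪⁅z⁆ x≢b x≢y))
                          (x∉p∧x∉q⇒x∉p∪q (x∉p⇒x∉p-y e′∉S) (x∉⁅y⁆∪⁅z⁆ (b≢e′ ∘ sym) (∈E*⇒≢y e′∈E*)))))
        renaming (set to C)
      m∉C : m ∉ C
      m∉C m∈C with x∈p∪q⁻ (S - x) ⁅ b ⁆ m∈S-x∪⁅b⁆
      ... | inj₁ m∈S-x = Disjoint-∪ˡ avoids m∈C m∈S-x
      ... | inj₂ m∈⁅b⁆ = Disjoint-∪ʳ avoids m∈C (p⊆p∪q ⁅ y ⁆ m∈⁅b⁆)

    Straddling-swap-agree : ∀ {S S′ b} → Straddling S → Straddling S′ → b ∉ S → b ∉ E → S′ ⊆ S ∪ ⁅ b ⁆ →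
                            𝓕 S ≡ 𝓕 S′
    Straddling-swap-agree {S} {S′} {b} straddling straddling′ b∉S b∉E S′⊆S∪⁅b⁆
      with Straddling.meets straddling | Straddling.misses straddling
    ... | e , e∈E* , e∈S | e′ , e′∈E* , e′∉S =
      Ambiguous-link intersecting (Straddling⇒Ambiguous P.straddling) (Straddling⇒Ambiguous straddling)
        (Straddling⇒Ambiguous straddling′) P.∩S⊆⁅x⁆ C∩S′⊆⁅x⁆
      where
      open Straddling straddling using (size; ∋x)
      b≢e′ : b ≢ e′
      b≢e′ refl = b∉E (E*⊆E e′∈E*)
      module P = StraddlingPartner (straddling-partner b size ∋x e′∈E* e′∉S b∉S b≢e′
                   e∈E* (p⊆p∪q ⁅ b ⁆ (x∈p∧x≢y⇒x∈p-y e∈S (∈E*⇒≢x e∈E*))))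
      C∩S′⊆⁅x⁆ : P.set ∩ S′ ⊆ ⁅ x ⁆
      C∩S′⊆⁅x⁆ z∈C∩S′ with x∈p∩q⁻ P.set S′ z∈C∩S′
      ... | z∈C , z∈S′ with x∈p∪q⁻ S ⁅ b ⁆ (S′⊆S∪⁅b⁆ z∈S′)
      ...   | inj₁ z∈S   = P.∩S⊆⁅x⁆ (x∈p∩q⁺ (z∈C , z∈S))
      ...   | inj₂ z∈⁅b⁆ rewrite x∈⁅y⁆⇒x≡y b z∈⁅b⁆ = contradiction z∈C P.∌b

    ∣E∣+∣E∪⁅y⁆∣≤n : ∣ E ∣ + ∣ E ∪ ⁅ y ⁆ ∣ ≤ n
    ∣E∣+∣E∪⁅y⁆∣≤n = begin
      ∣ E ∣ + ∣ E ∪ ⁅ y ⁆ ∣       ≤⟨ +-monoʳ-≤ ∣ E ∣ (∣p∪q∣≤∣p∣+∣q∣ E ⁅ y ⁆) ⟩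
      ∣ E ∣ + (∣ E ∣ + ∣ ⁅ y ⁆ ∣) ≡⟨ cong (λ m → ∣ E ∣ + (∣ E ∣ + m)) (∣⁅x⁆∣≡1 y) ⟩
      ∣ E ∣ + (∣ E ∣ + 1)         ≡⟨ cong (∣ E ∣ +_) (trans (+-comm ∣ E ∣ 1) 1+∣E∣≡k) ⟩
      ∣ E ∣ + k                   ≤⟨ +-mono-≤ (≤-trans (n≤1+n ∣ E ∣) (≤-reflexive 1+∣E∣≡k)) (n≤1+n k) ⟩
      k + suc k                   ≤⟨ k+1+k≤n ⟩
      n                           ∎
      where open ≤-Reasoning

    open Extension (extend ∣ E ∣ ⁅ x ⁆ (E ∪ ⁅ y ⁆) (Disjoint-⁅x⁆ (x∉p∧x∉q⇒x∉p∪q x∉E (x≢y⇒x∉⁅y⁆ x≢y)))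
                     (≤-trans (≤-reflexive (∣⁅x⁆∣≡1 x)) (≤-trans (s≤s z≤n) 3≤∣E∣)) ∣E∣+∣E∪⁅y⁆∣≤n)
      using () renaming (set to W; size to ∣W∣≡∣E∣; ⊇A to ⁅x⁆⊆W; avoids to W#E∪⁅y⁆)

    ∈W⇒∉E : i ∈ W → i ∉ E
    ∈W⇒∉E i∈W = W#E∪⁅y⁆ i∈W ∘ p⊆p∪q ⁅ y ⁆

    ∈W⇒≢y : i ∈ W → i ≢ y
    ∈W⇒≢y i∈W refl = W#E∪⁅y⁆ i∈W (q⊆p∪q E ⁅ y ⁆ (x∈⁅x⁆ y))

    T : Fin n → Subset n
    T e = W ∪ ⁅ e ⁆

    ∈T⁻ : ∀ {e} → i ∈ T e → i ∈ W ⊎ i ≡ e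
    ∈T⁻ {e = e} i∈T with x∈p∪q⁻ W ⁅ e ⁆ i∈T
    ... | inj₁ i∈W   = inj₁ i∈W
    ... | inj₂ i∈⁅e⁆ = inj₂ (x∈⁅y⁆⇒x≡y e i∈⁅e⁆)

    x∈T : ∀ e → x ∈ T e
    x∈T e = p⊆p∪q ⁅ e ⁆ (⁅x⁆⊆W (x∈⁅x⁆ x))

    e∈T : ∀ e → e ∈ T e
    e∈T e = q⊆p∪q W ⁅ e ⁆ (x∈⁅x⁆ e)

    ∣T∣≡k : ∀ {e} → e ∈ E* → ∣ T e ∣ ≡ k
    ∣T∣≡k {e} e∈E* = begin
      ∣ W ∪ ⁅ e ⁆ ∣       ≡⟨ ∣p∪q∣≡∣p∣+∣q∣ W ⁅ e ⁆ (Disjoint-sym (Disjoint-⁅x⁆ λ e∈W → ∈W⇒∉E e∈W (E*⊆E e∈E*))) ⟩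
      ∣ W ∣ + ∣ ⁅ e ⁆ ∣   ≡⟨ cong₂ _+_ ∣W∣≡∣E∣ (∣⁅x⁆∣≡1 e) ⟩
      ∣ E ∣ + 1           ≡⟨ +-comm ∣ E ∣ 1 ⟩
      suc ∣ E ∣           ≡⟨ 1+∣E∣≡k ⟩
      k                   ∎
      where open ≡-Reasoning

    Straddling-swap-step : ∀ {S e a b} → e ∈ E* → Straddling S → e ∈ S → a ∈ S → a ∉ T e → b ∈ T e → b ∉ S →
                           Straddling (swapOut b a S) × e ∈ swapOut b a S × 𝓕 S ≡ 𝓕 (swapOut b a S)
    Straddling-swap-step {S} {e} {a} {b} e∈E* straddling e∈S a∈S a∉T b∈T b∉S =
      straddling′ , e∈S′ , Straddling-swap-agree straddling straddling′ b∉S (∈W⇒∉E b∈W) S′⊆S∪⁅b⁆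
      where
      open Straddling straddling
      b∈W : b ∈ W
      b∈W = [ (λ b∈W → b∈W) , (λ { refl → contradiction e∈S b∉S }) ]′ (∈T⁻ b∈T)
      b≢a : b ≢ a
      b≢a refl = a∉T b∈T
      ∈T⇒≢a : i ∈ T e → i ≢ a
      ∈T⇒≢a i∈T refl = a∉T i∈T
      ∈S′⁻ : i ∈ swapOut b a S → i ≡ b ⊎ (i ≢ a × i ∈ S)
      ∈S′⁻ = ∈-swapOut⁻ b a S b≢a
      S′⊆S∪⁅b⁆ : swapOut b a S ⊆ S ∪ ⁅ b ⁆
      S′⊆S∪⁅b⁆ z∈S′ with ∈S′⁻ z∈S′
      ... | inj₁ refl      = q⊆p∪q S ⁅ b ⁆ (x∈⁅x⁆ b)
      ... | inj₂ (_ , z∈S) = p⊆p∪q ⁅ b ⁆ z∈S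
      e∈S′ : e ∈ swapOut b a S
      e∈S′ = swapOut-keeps b a S (∈T⇒≢a (e∈T e)) e∈S
      straddling′ : Straddling (swapOut b a S)
      straddling′ with misses
      ... | e′ , e′∈E* , e′∉S = record
        { size   = trans (∣swapOut∣ b a S b∉S a∈S) size
        ; ∋x     = swapOut-keeps b a S (∈T⇒≢a (x∈T e)) ∋x
        ; ∌y     = [ (λ { refl → ∈W⇒≢y b∈W refl }) , ∌y ∘ proj₂ ]′ ∘ ∈S′⁻
        ; meets  = e , e∈E* , e∈S′
        ; misses = e′ , e′∈E* , [ (λ { refl → ∈W⇒∉E b∈W (E*⊆E e′∈E*) }) , e′∉S ∘ proj₂ ]′ ∘ ∈S′⁻
        }

    private
      Straddling≈T-fuel : ∀ {S e} d → ∣ S ─ T e ∣ Nat.< d → e ∈ E* → Straddling S → e ∈ S → 𝓕 S ≡ 𝓕 (T e)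
      Straddling≈T-fuel {S} {e} (suc d) ∣S─T∣<1+d e∈E* straddling e∈S with S ⊆? T e
      ... | yes S⊆T = cong 𝓕 (p⊆q∧∣p∣≡∣q∣⇒p≡q S⊆T (trans (Straddling.size straddling) (sym (∣T∣≡k e∈E*))))
      ... | no  S⊈T with p⊈q⇒∃x∈p∖q S (T e) S⊈T
      ...   | a , a∈S , a∉T = trans 𝓕S≡𝓕S′ (Straddling≈T-fuel d ∣S′─T∣<d e∈E* straddling′ e∈S′)
        where
        b∈T∖S : ∃ λ b → b ∈ T e × b ∉ S
        b∈T∖S = ∣p∣≡∣q∣∧x∈p∖q⇒∃y∈q∖p S (T e) (trans (Straddling.size straddling) (sym (∣T∣≡k e∈E*))) a∈S a∉T
        b : Fin n
        b = proj₁ b∈T∖S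
        step : Straddling (swapOut b a S) × e ∈ swapOut b a S × 𝓕 S ≡ 𝓕 (swapOut b a S)
        step = Straddling-swap-step e∈E* straddling e∈S a∈S a∉T (proj₁ (proj₂ b∈T∖S)) (proj₂ (proj₂ b∈T∖S))
        straddling′ : Straddling (swapOut b a S)
        straddling′ = proj₁ step
        e∈S′ : e ∈ swapOut b a S
        e∈S′ = proj₁ (proj₂ step)
        𝓕S≡𝓕S′ : 𝓕 S ≡ 𝓕 (swapOut b a S)
        𝓕S≡𝓕S′ = proj₂ (proj₂ step)
        ∣S′─T∣<d : ∣ swapOut b a S ─ T e ∣ Nat.< d
        ∣S′─T∣<d = ≤-trans (∣swapOut─∣<∣─∣ S (T e) (x∈p∧x∉q⇒x∈p─q a∈S a∉T) (proj₁ (proj₂ b∈T∖S)))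
                           (≤-pred ∣S─T∣<1+d)

    Straddling≈T : ∀ {S e} → e ∈ E* → Straddling S → e ∈ S → 𝓕 S ≡ 𝓕 (T e)
    Straddling≈T = Straddling≈T-fuel _ (n<1+n _)

    -- If ∣E*∣ = 2, a set straddling E* cannot avoid both T e and T e′ outside x, so the two
    -- are connected through a straddling S₁ ∋ e and a straddling partner S₂ ∋ e′ of S₁.
    T≈T : ∀ {e e′} → e ∈ E* → e′ ∈ E* → 𝓕 (T e) ≡ 𝓕 (T e′)
    T≈T {e} {e′} e∈E* e′∈E* with e ≟ e′
    ... | yes refl = refl
    ... | no  e≢e′ = begin
      𝓕 (T e)  ≡⟨ Straddling≈T e∈E* S₁-straddling e∈S₁ ⟨
      𝓕 S₁.set ≡⟨ Ambiguous-agree intersecting (Straddling⇒Ambiguous S₂.straddling)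
                    (Straddling⇒Ambiguous S₁-straddling) S₂.∩S⊆⁅x⁆ ⟨
      𝓕 S₂.set ≡⟨ Straddling≈T e′∈E* S₂.straddling S₂.∋e′ ⟩
      𝓕 (T e′) ∎
      where
      open ≡-Reasoning
      module S₁ = Extension (extend k (⁅ x ⁆ ∪ ⁅ e ⁆) (⁅ e′ ⁆ ∪ ⁅ y ⁆)
        (Disjoint-⁅x⁆∪⁅y⁆ (x∉⁅y⁆∪⁅z⁆ (∈E*⇒≢x e′∈E* ∘ sym) x≢y) (x∉⁅y⁆∪⁅z⁆ e≢e′ (∈E*⇒≢y e∈E*)))
        (∣⁅x⁆∪⁅y⁆∣≤k x e) (≤-trans (+-monoʳ-≤ k (≤-trans (∣⁅x⁆∪⁅y⁆∣≤2 e′ y) (≤-trans 2≤k (n≤1+n k)))) k+1+k≤n))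
      e∈S₁ : e ∈ S₁.set
      e∈S₁ = S₁.⊇A (y∈⁅x⁆∪⁅y⁆ x e)
      e′∉S₁ : e′ ∉ S₁.set
      e′∉S₁ e′∈S₁ = S₁.avoids e′∈S₁ (x∈⁅x⁆∪⁅y⁆ e′ y)
      y∉S₁ : y ∉ S₁.set
      y∉S₁ y∈S₁ = S₁.avoids y∈S₁ (y∈⁅x⁆∪⁅y⁆ e′ y)
      S₁-straddling : Straddling S₁.set
      S₁-straddling = record
        { size   = S₁.size
        ; ∋x     = S₁.⊇A (x∈⁅x⁆∪⁅y⁆ x e)
        ; ∌y     = y∉S₁
        ; meets  = e , e∈E* , e∈S₁
        ; misses = e′ , e′∈E* , e′∉S₁
        }
      module S₂ = StraddlingPartner (straddling-partner y S₁.size (Straddling.∋x S₁-straddling) e′∈E* e′∉S₁ y∉S₁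
                    (∈E*⇒≢y e′∈E* ∘ sym) e∈E* (p⊆p∪q ⁅ y ⁆ (x∈p∧x≢y⇒x∈p-y e∈S₁ (∈E*⇒≢x e∈E*))))

    e₀∈E*×e₀≢x : ∃ λ e → e ∈ E* × e ≢ x
    e₀∈E*×e₀≢x = ∃E*∖⁅j⁆ x

    e₀ : Fin n
    e₀ = proj₁ e₀∈E*×e₀≢x

    e₀∈E* : e₀ ∈ E*
    e₀∈E* = proj₁ (proj₂ e₀∈E*×e₀≢x)

    Straddling≈T₀ : Straddling G → 𝓕 G ≡ 𝓕 (T e₀)
    Straddling≈T₀ straddling with Straddling.meets straddling
    ... | e , e∈E* , e∈G = trans (Straddling≈T e∈E* straddling e∈G) (T≈T e∈E* e₀∈E*)

    E*-free≈T₀ : Ambiguous H → (∀ {e} → e ∈ E* → e ∉ H) → 𝓕 H ≡ 𝓕 (T e₀)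
    E*-free≈T₀ {H = H} amb E*∌H with ∃E*∖⁅j⁆ e₀
    ... | e₁ , e₁∈E* , e₁≢e₀ =
      trans (sym (Ambiguous-agree intersecting (Straddling⇒Ambiguous P.straddling) amb P.∩S⊆⁅x⁆))
            (Straddling≈T₀ P.straddling)
      where
      open Ambiguous amb
      module P = StraddlingPartner (straddling-partner e₁ (proj₁ inQ) ∋x e₀∈E* (E*∌H e₀∈E*) (E*∌H e₁∈E*) e₁≢e₀
                   e₁∈E* (q⊆p∪q (H - x) ⁅ e₁ ⁆ (x∈⁅x⁆ e₁)))

    E*⊆≈T₀ : Ambiguous H → E* ⊆ H → 𝓕 H ≡ 𝓕 (T e₀)
    E*⊆≈T₀ {H = H} amb E*⊆H =
      trans (sym (Ambiguous-agree intersecting C-ambiguous amb (Disjoint-[p-x]∪q⇒∩⊆⁅x⁆ avoids)))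
            (E*-free≈T₀ C-ambiguous ∈E*⇒∉C)
      where
      open Ambiguous amb
      E⊆up : E ⊆ up H
      E⊆up {i} i∈E with i ≟ y
      ... | yes refl = y∈up
      ... | no  i≢y  = up-keeps (∈E*⇒≢x i∈E*) (E*⊆H i∈E*)
        where
        i∈E* : i ∈ E*
        i∈E* = x∈p∧x≢y⇒x∈p-y i∈E i≢y
      up∩J-empty : Empty (up H ∩ J)
      up∩J-empty up∩J≢∅ = Ambiguous⇒¬Shape-up amb (inj₁ (E⊆up , up∩J≢∅))
      y∉J : y ∉ J
      y∉J y∈J = up∩J-empty (y , x∈p∩q⁺ (y∈up , y∈J))
      ∈J⇒∉H : i ∈ J → i ∉ H
      ∈J⇒∉H i∈J i∈H = up∩J-empty (_ , x∈p∩q⁺ (up-keeps (λ { refl → x∉J i∈J }) i∈H , i∈J))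
      J∪⁅x⁆#H-x∪⁅y⁆ : Disjoint (J ∪ ⁅ x ⁆) ((H - x) ∪ ⁅ y ⁆)
      J∪⁅x⁆#H-x∪⁅y⁆ = Disjoint-∪⁺
        (λ i∈J → x∉p∧x∉q⇒x∉p∪q (x∉p⇒x∉p-y (∈J⇒∉H i∈J)) (x≢y⇒x∉⁅y⁆ λ { refl → y∉J i∈J }))
        (Disjoint-⁅x⁆ (x∉p∧x∉q⇒x∉p∪q (x∉p-x H x) (x≢y⇒x∉⁅y⁆ x≢y)))
      ∣J∪⁅x⁆∣≤k : ∣ J ∪ ⁅ x ⁆ ∣ ≤ k
      ∣J∪⁅x⁆∣≤k = ≤-trans (∣p∪q∣≤∣p∣+∣q∣ J ⁅ x ⁆) (≤-trans (≤-reflexive (cong₂ _+_ ∣J∣≡3 (∣⁅x⁆∣≡1 x))) 4≤k)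
      open Extension (partner {S = H} (J ∪ ⁅ x ⁆) ⁅ y ⁆ (proj₁ inQ) ∋x ∣J∪⁅x⁆∣≤k
        (≤-trans (≤-reflexive (∣⁅x⁆∣≡1 y)) (s≤s z≤n)) J∪⁅x⁆#H-x∪⁅y⁆) renaming (set to C)
      ∈E*⇒∉C : ∀ {e} → e ∈ E* → e ∉ C
      ∈E*⇒∉C e∈E* e∈C = Disjoint-∪ˡ avoids e∈C (x∈p∧x≢y⇒x∈p-y (E*⊆H e∈E*) (∈E*⇒≢x e∈E*))
      C-ambiguous : Ambiguous C
      C-ambiguous = ambiguous
        (size , inj₂ (inj₁ (subst (λ z → J ∪ ⁅ z ⁆ ⊆ C) x≡x₀ ⊇A)))
        (⊇A (q⊆p∪q J ⁅ x ⁆ (x∈⁅x⁆ x)))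
        (λ y∈C → Disjoint-∪ʳ avoids y∈C (x∈⁅x⁆ y))
        (λ (_ , shape) → ∈E∧∉up⇒¬Shape-up (E*⊆E e₀∈E*) (∉up (∈E*⇒≢y e₀∈E*) (∈E*⇒∉C e₀∈E*)) shape)

    constant : Σ Bool Constant
    constant = 𝓕 (T e₀) , agree
      where
      agree : Constant (𝓕 (T e₀))
      agree {H} amb with nonempty? (H ∩ E*) | E* ⊆? H
      ... | no  H∩E*-empty | _        = E*-free≈T₀ amb λ e∈E* e∈H → H∩E*-empty (_ , x∈p∩q⁺ (e∈H , e∈E*))
      ... | yes _          | yes E*⊆H = E*⊆≈T₀ amb E*⊆H
      ... | yes (e , e∈H∩E*) | no E*⊈H = Straddling≈T₀ (record
        { size   = proj₁ inQ
        ; ∋x     = ∋x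
        ; ∌y     = ∌y
        ; meets  = e , proj₂ (x∈p∩q⁻ H E* e∈H∩E*) , proj₁ (x∈p∩q⁻ H E* e∈H∩E*)
        ; misses = p⊈q⇒∃x∈p∖q E* H E*⊈H
        })
        where open Ambiguous amb

  Ambiguous-constant : Σ Bool Constant
  Ambiguous-constant with x ≟ x₀
  ... | yes x≡x₀ = x≡x₀-Case.constant x≡x₀
  ... | no  x≢x₀ with y ∈? E
  ...   | yes y∈E = true , λ amb → ⊥-elim (no-Ambiguous-if-y∈E x≢x₀ y∈E amb)
  ...   | no  y∉E with y ≟ x₀
  ...     | yes y≡x₀ = true , λ amb → ⊥-elim (no-Ambiguous-if-y≡x₀ y≡x₀ amb)
  ...     | no  y≢x₀ with x ∈? E
  ...       | yes x∈E = x∈E-Case.constant x∈E y∉E y≢x₀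
  ...       | no  x∉E with x ∈? J | y ∈? J
  ...         | yes x∈J | no  y∉J = x∈J-Case.constant x∈J y∉E y≢x₀ y∉J
  ...         | yes _   | yes y∈J = true , λ amb → ⊥-elim (no-Ambiguous-if-x∉E∪⁅x₀⁆ x∉E x≢x₀ (λ _ → y∈J) amb)
  ...         | no  x∉J | _       =
    true , λ amb → ⊥-elim (no-Ambiguous-if-x∉E∪⁅x₀⁆ x∉E x≢x₀ (λ x∈J → contradiction x∈J x∉J) amb)

lemma2p13 : (k n : ℕ) → 4 ≤ k → 2 * k + 1 ≤ n → (𝓕 : Family n) →
    Uniform k 𝓕 → Intersecting 𝓕 →
    (x y : Fin n) → x < y → IsJ3 k (λ G → G ∈Shift[ 𝓕 , x , y ]) →
    Σ (Permutation′ n) λ σ → IsJ3 k (λ G → G ∈Perm[ 𝓕 , σ ])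
lemma2p13 k n 4≤k 2k+1≤n 𝓕 _ intersecting x y x<y (E , x₀ , J , params , shift≈J3)
  with Constant⇒permuted Ambiguous-constant
  where open J3Shift k 4≤k 2k+1≤n 𝓕 intersecting (<⇒≢ x<y) params shift≈J3
... | σ , σ𝓕≈J3 = σ , E , x₀ , J , params , σ𝓕≈J3
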